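{- Let $F$ be a field of characteristic not $2$. Let $L/F$ be an elementary abelian extension and $y\in L$ a biquadratic generator with minimal polynomial $P(X)=X^4+uX^2+w^2\in F[X]$ ($u,w\in F$). Let $L'/F$ be a biquadratic extension and $y'\in L'$ a biquadratic generator with minimal polynomial $Q(X)=X^4+vX^2+z^2\in F[X]$ ($v,z\in F$). Then $L/F$ and $L'/F$ are $F$-isomorphic if and only if at least one of the following holds: \begin{enumerate} \item $\frac{ -v-2z}{ -u+2w}\in F^2$ and $\frac{ -v+2z}{ -u-2w}\in F^2$; \item $\frac{ -v-2z}{ -u+2w}\in F^2$ and $\frac{ -v+2z}{u^2-4w^2}\in F^2$; \item $\frac{ -v-2z}{ -u-2w}\in F^2$ and $\frac{ -v+2z}{ -u+2w}\in F^2$; \item $\frac{ -v-2z}{ -u-2w}\in F^2$ and $\frac{ -v+2z}{u^2-4w^2}\in F^2$; \item $\frac{ -v-2z}{u^2-4w^2}\in F^2$ and $\frac{ -v+2z}{ -u-2w}\in F^2$; \item $\frac{ -v-2z}{u^2-4w^2}\in F^2$ and $\frac{ -v+2z}{ -u+2w}\in F^2$. \end{enumerate}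
   Context: $F$ is a field of characteristic different from $2$. A quartic extension is elementary abelian if it is Galois with Galois group $\mathbb{Z}/2\mathbb{Z}\times\mathbb{Z}/2\mathbb{Z}$. A quartic extension is biquadratic if it has a primitive element (biquadratic generator) with minimal polynomial of the form $X^4+uX^2+w$, $u,w\in F$. $F$-isomorphic means isomorphic via a ring isomorphism fixing $F$; $F^2$ is the set of squares in $F$. -}

module Defs where

open import Level using (Level; _⊔_) renaming (suc to lsuc)
open import Algebra.Bundles using (CommutativeRing)
open import Data.Product using (Σ; ∃; _×_; _,_)
open import Data.Sum using (_⊎_)
open import Data.Fin using (Fin; zero; suc)
open import Relation.Nullary using (¬_)

record Field (c ℓ : Level) : Set (lsuc (c ⊔ ℓ)) where
  field
    cring : CommutativeRing c ℓ
  open CommutativeRing cring public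
  field
    1≉0     : ¬ (1# ≈ 0#)
    inverse : ∀ x → ¬ (x ≈ 0#) → ∃ λ y → x * y ≈ 1#

CharNot2 : ∀ {c ℓ} → Field c ℓ → Set ℓ
CharNot2 F = ¬ ((1# + 1#) ≈ 0#) where open Field F

-- a / b ∈ F² : the denominator is nonzero and a = c² · b for some c ∈ F
-- (i.e. a · b⁻¹ = c², division written out)
SquareQuot : ∀ {c ℓ} (F : Field c ℓ) → Field.Carrier F → Field.Carrier F → Set (c ⊔ ℓ)
SquareQuot F a b = (¬ (b ≈ 0#)) × (∃ λ s → a ≈ (s * s) * b) where open Field F

record Extension {c ℓ} (F : Field c ℓ) (c' ℓ' : Level) : Set (lsuc (c ⊔ ℓ ⊔ c' ⊔ ℓ')) where
  field
    L : Field c' ℓ'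
  private
    module F = Field F
    module L = Field L
  field
    ι      : F.Carrier → L.Carrier
    ι-cong : ∀ {a b} → a F.≈ b → ι a L.≈ ι b
    ι-+    : ∀ a b → ι (a F.+ b) L.≈ ι a L.+ ι b
    ι-*    : ∀ a b → ι (a F.* b) L.≈ ι a L.* ι b
    ι-1    : ι F.1# L.≈ L.1#

module _ {c ℓ c' ℓ'} {F : Field c ℓ} (E : Extension F c' ℓ') where
  private
    module F = Field F
  open Extension E
  open Field L hiding (zero)

  lin4 : (Fin 4 → F.Carrier) → (Fin 4 → Carrier) → Carrier
  lin4 a b = ι (a zero) * b zero + (ι (a (suc zero)) * b (suc zero)
           + (ι (a (suc (suc zero))) * b (suc (suc zero))
           + ι (a (suc (suc (suc zero)))) * b (suc (suc (suc zero)))))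

  Spans4 : (Fin 4 → Carrier) → Set (c ⊔ c' ⊔ ℓ')
  Spans4 b = ∀ x → ∃ λ a → x ≈ lin4 a b

  Independent4 : (Fin 4 → Carrier) → Set (c ⊔ ℓ ⊔ ℓ')
  Independent4 b = ∀ a → lin4 a b ≈ 0# → ∀ i → a i F.≈ F.0#

  IsQuartic : Set (c ⊔ ℓ ⊔ c' ⊔ ℓ')
  IsQuartic = ∃ λ b → Spans4 b × Independent4 b

  powers : Carrier → Fin 4 → Carrier
  powers y zero = 1#
  powers y (suc zero) = y
  powers y (suc (suc zero)) = y * y
  powers y (suc (suc (suc zero))) = y * y * y

  -- The minimal polynomial of y over F is X⁴ + uX² + w :
  -- y is a root, and no nonzero polynomial of degree < 4 over F vanishes at y
  -- (so this monic quartic has least degree among polynomials killing y).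
  MinPolyIs : Carrier → F.Carrier → F.Carrier → Set (c ⊔ ℓ ⊔ ℓ')
  MinPolyIs y u w =
    ((y * y * y * y + ι u * (y * y) + ι w) ≈ 0#) × Independent4 (powers y)

  Primitive4 : Carrier → Set (c ⊔ c' ⊔ ℓ')
  Primitive4 y = Spans4 (powers y)

  BiquadGen : Carrier → F.Carrier → F.Carrier → Set (c ⊔ ℓ ⊔ c' ⊔ ℓ')
  BiquadGen y u w = Primitive4 y × MinPolyIs y u w

  IsBiquadratic : Set (c ⊔ ℓ ⊔ c' ⊔ ℓ')
  IsBiquadratic = IsQuartic × ∃ λ y → ∃ λ u → ∃ λ w → BiquadGen y u w

  IsFHom : (Carrier → Carrier) → Set (c ⊔ c' ⊔ ℓ')
  IsFHom σ = (∀ {x y} → x ≈ y → σ x ≈ σ y)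
           × (∀ x y → σ (x + y) ≈ σ x + σ y)
           × (∀ x y → σ (x * y) ≈ σ x * σ y)
           × (σ 1# ≈ 1#)
           × (∀ a → σ (ι a) ≈ ι a)

  _≐_ : (Carrier → Carrier) → (Carrier → Carrier) → Set (c' ⊔ ℓ')
  σ ≐ τ = ∀ x → σ x ≈ τ x

  IsFAut : (Carrier → Carrier) → Set (c ⊔ c' ⊔ ℓ')
  IsFAut σ = IsFHom σ × ∃ λ σ⁻ → IsFHom σ⁻ × (∀ x → σ (σ⁻ x) ≈ x) × (∀ x → σ⁻ (σ x) ≈ x)

  idL : Carrier → Carrier
  idL x = x

  -- L/F is elementary abelian: quartic, Galois, with Galois group Z/2 × Z/2.
  -- Aut_F(L) = {id, σ, τ, σ∘τ} with σ² = τ² = id, στ = τσ, four distinct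
  -- elements; so |Aut_F(L)| = 4 = [L : F] (Galois) and the group is V₄.
  IsElementaryAbelian : Set (c ⊔ ℓ ⊔ c' ⊔ ℓ')
  IsElementaryAbelian = IsQuartic × ∃ λ σ → ∃ λ τ →
      IsFAut σ × IsFAut τ
    × (σ ∘' σ) ≐ idL × (τ ∘' τ) ≐ idL × (σ ∘' τ) ≐ (τ ∘' σ)
    × ¬ (idL ≐ σ) × ¬ (idL ≐ τ) × ¬ (σ ≐ τ)
    × ¬ (idL ≐ (σ ∘' τ)) × ¬ (σ ≐ (σ ∘' τ)) × ¬ (τ ≐ (σ ∘' τ))
    × (∀ ρ → IsFAut ρ → (ρ ≐ idL) ⊎ (ρ ≐ σ) ⊎ (ρ ≐ τ) ⊎ (ρ ≐ (σ ∘' τ)))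
    where
      _∘'_ : (Carrier → Carrier) → (Carrier → Carrier) → Carrier → Carrier
      (f ∘' g) x = f (g x)

FIsomorphic : ∀ {c ℓ c₁ ℓ₁ c₂ ℓ₂} {F : Field c ℓ} →
  Extension F c₁ ℓ₁ → Extension F c₂ ℓ₂ → Set (c ⊔ c₁ ⊔ ℓ₁ ⊔ c₂ ⊔ ℓ₂)
FIsomorphic {F = F} E E' =
  ∃ λ (φ : L.Carrier → L'.Carrier) → ∃ λ (ψ : L'.Carrier → L.Carrier) →
      (∀ {x y} → x L.≈ y → φ x L'.≈ φ y)
    × (∀ x y → φ (x L.+ y) L'.≈ φ x L'.+ φ y)
    × (∀ x y → φ (x L.* y) L'.≈ φ x L'.* φ y)
    × (φ L.1# L'.≈ L'.1#)
    × (∀ a → φ (Extension.ι E a) L'.≈ Extension.ι E' a)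
    × (∀ {x y} → x L'.≈ y → ψ x L.≈ ψ y)
    × (∀ x → ψ (φ x) L.≈ x)
    × (∀ x → φ (ψ x) L'.≈ x)
  where
    module L = Field (Extension.L E)
    module L' = Field (Extension.L E')

-- Put k = w/y. Then s = y + k and t = y − k satisfy s² = a := −u + 2w and t² = b := −u − 2w, and
-- 1, s, t, st is an F-basis of L; in the same way L′ has a basis 1, s′, t′ with s′² = a′, t′² = b′.
-- The nontrivial F-automorphisms of L are the three reflections fixing one of the lines Fs, Ft, Fst
-- and negating the other two; the elementary-abelian hypothesis is what lets us decide which
-- automorphism is which. An F-isomorphism L′ ≅ L sends s′ and t′ to elements that are negated by
-- one reflection and fixed by another, i.e. onto two distinct lines, so a′ and b′ lie in the square
-- classes of two distinct elements among a, b, ab. Conversely, two such lines form a basis of L with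
-- squares in the classes of a′ and b′, and matching square classes yield an isomorphism.
module Submission where

open import Level using (_⊔_)
open import Algebra.Bundles using (CommutativeRing; RawRing; Semiring)
import Algebra.Solver.Ring.AlmostCommutativeRing as ACR
open import Relation.Binary.Bundles using (Setoid)
open import Data.Nat.Base as ℕ using (ℕ)
open import Data.Nat.Properties using () renaming (_≟_ to _≟ℕ_)
open import Data.Fin.Base using (Fin)
open import Data.Fin.Patterns using (0F; 1F; 2F; 3F; 4F; 5F; 6F; 7F; 8F; 9F)
open import Data.Vec.Base using (Vec; _∷_; []; lookup)
open import Data.Product.Base using (Σ; ∃; ∃₂; _×_; _,_; proj₁; proj₂)
open import Data.Sum.Base using (_⊎_; inj₁; inj₂; [_,_]′)
open import Data.Maybe.Base using (Maybe; just; nothing)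
open import Data.Empty using (⊥-elim)
open import Function.Base using (_∘_; case_of_)
open import Function.Bundles using (_⇔_; mk⇔)
open import Relation.Nullary.Negation.Core using (¬_)
open import Relation.Nullary.Decidable.Core using (Dec; yes; no)
open import Relation.Binary.PropositionalEquality.Core as ≡ using (_≡_; _≢_)
open import Tactic.RingSolver.Core.Expression as Expression using (Expr; Κ; Ι; _⊕_; _⊗_; _⊛_; ⊝_)
open import Defs

module ℤ-RingSolver {c ℓ} (R : CommutativeRing c ℓ) where
  open CommutativeRing R
  open import Algebra.Properties.Semiring.Mult.TCOptimised semiring using (×-homo-+; ×1-homo-*) renaming (_×_ to _×ᴿ_)
  open import Algebra.Properties.Ring ring using (-0#≈0#; x[y-z]≈xy-xz; [y-z]x≈yx-zx)
  open import Algebra.Properties.AbelianGroup +-abelianGroup using (⁻¹-∙-comm; ⁻¹-anti-homo‿-)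
  open import Algebra.Properties.CommutativeSemigroup +-commutativeSemigroup using (interchange)
  open import Relation.Binary.Reasoning.Setoid setoid

  -- an integer as a difference m - n of naturals, normalised (m or n is 0) so that equal integers are
  -- syntactically equal, as the solver compares normal forms up to ≡
  Diff : Set
  Diff = ℕ × ℕ

  normal : ℕ → ℕ → Diff
  normal m n = m ℕ.∸ n , n ℕ.∸ m

  ℤ-rawRing : RawRing _ _
  ℤ-rawRing = record
    { Carrier = Diff ; _≈_ = _≡_
    ; _+_ = λ (m , n) (m′ , n′) → normal (m ℕ.+ m′) (n ℕ.+ n′)
    ; _*_ = λ (m , n) (m′ , n′) → normal (m ℕ.* m′ ℕ.+ n ℕ.* n′) (m ℕ.* n′ ℕ.+ n ℕ.* m′)
    ; -_ = λ (m , n) → n , m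
    ; 0# = 0 , 0 ; 1# = 1 , 0 }

  -- m - 0 is interpreted as m ×ᴿ 1#, so that the constants 0#, 1#, 1# + 1#, … are recognised
  ⟦_⟧ℤ : Diff → Carrier
  ⟦ m , ℕ.zero  ⟧ℤ = m ×ᴿ 1#
  ⟦ m , ℕ.suc n ⟧ℤ = m ×ᴿ 1# - ℕ.suc n ×ᴿ 1#

  ⟦⟧ℤ-sub : ∀ m n → ⟦ m , n ⟧ℤ ≈ m ×ᴿ 1# - n ×ᴿ 1#
  ⟦⟧ℤ-sub m ℕ.zero    = sym (trans (+-congˡ -0#≈0#) (+-identityʳ _))
  ⟦⟧ℤ-sub m (ℕ.suc n) = refl

  -‿+-interchange : ∀ x x′ y y′ → (x + x′) - (y + y′) ≈ (x - y) + (x′ - y′)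
  -‿+-interchange x x′ y y′ = trans (+-congˡ (sym (⁻¹-∙-comm y y′))) (interchange x x′ (- y) (- y′))

  -‿*-expand : ∀ x x′ y y′ → (x * x′ + y * y′) - (x * y′ + y * x′) ≈ (x - y) * (x′ - y′)
  -‿*-expand x x′ y y′ = sym (begin
    (x - y) * (x′ - y′)                          ≈⟨ [y-z]x≈yx-zx (x′ - y′) x y ⟩
    x * (x′ - y′) - y * (x′ - y′)                ≈⟨ +-cong (x[y-z]≈xy-xz x x′ y′) (-‿cong (x[y-z]≈xy-xz y x′ y′)) ⟩
    (x * x′ - x * y′) - (y * x′ - y * y′)        ≈⟨ +-congˡ (⁻¹-anti-homo‿- _ _) ⟩
    (x * x′ - x * y′) + (y * y′ - y * x′)        ≈⟨ interchange _ _ _ _ ⟩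
    (x * x′ + y * y′) + (- (x * y′) - y * x′)    ≈⟨ +-congˡ (⁻¹-∙-comm _ _) ⟩
    (x * x′ + y * y′) - (x * y′ + y * x′)        ∎)

  normal-sound : ∀ m n → ⟦ normal m n ⟧ℤ ≈ m ×ᴿ 1# - n ×ᴿ 1#
  normal-sound ℕ.zero    ℕ.zero    = ⟦⟧ℤ-sub 0 0
  normal-sound ℕ.zero    (ℕ.suc n) = refl
  normal-sound (ℕ.suc m) ℕ.zero    = ⟦⟧ℤ-sub (ℕ.suc m) 0
  normal-sound (ℕ.suc m) (ℕ.suc n) = trans (normal-sound m n) (sym (begin
    ℕ.suc m ×ᴿ 1# - ℕ.suc n ×ᴿ 1#      ≈⟨ +-cong (×-homo-+ 1# 1 m) (-‿cong (×-homo-+ 1# 1 n)) ⟩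
    (1# + m ×ᴿ 1#) - (1# + n ×ᴿ 1#)    ≈⟨ -‿+-interchange _ _ _ _ ⟩
    (1# - 1#) + (m ×ᴿ 1# - n ×ᴿ 1#)    ≈⟨ +-congʳ (-‿inverseʳ 1#) ⟩
    0# + (m ×ᴿ 1# - n ×ᴿ 1#)           ≈⟨ +-identityˡ _ ⟩
    m ×ᴿ 1# - n ×ᴿ 1#                  ∎))

  homomorphism : ℤ-rawRing ACR.-Raw-AlmostCommutative⟶ ACR.fromCommutativeRing R
  homomorphism = record
    { ⟦_⟧    = ⟦_⟧ℤ
    ; +-homo = λ (m , n) (m′ , n′) → trans (normal-sound (m ℕ.+ m′) (n ℕ.+ n′))
        (trans (+-cong (×-homo-+ 1# m m′) (-‿cong (×-homo-+ 1# n n′)))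
        (trans (-‿+-interchange _ _ _ _) (sym (+-cong (⟦⟧ℤ-sub m n) (⟦⟧ℤ-sub m′ n′)))))
    ; *-homo = λ (m , n) (m′ , n′) → trans (normal-sound (m ℕ.* m′ ℕ.+ n ℕ.* n′) (m ℕ.* n′ ℕ.+ n ℕ.* m′)) (trans
        (+-cong (trans (×-homo-+ 1# (m ℕ.* m′) (n ℕ.* n′)) (+-cong (×1-homo-* m m′) (×1-homo-* n n′)))
                (-‿cong (trans (×-homo-+ 1# (m ℕ.* n′) (n ℕ.* m′)) (+-cong (×1-homo-* m n′) (×1-homo-* n m′)))))
        (trans (-‿*-expand _ _ _ _) (sym (*-cong (⟦⟧ℤ-sub m n) (⟦⟧ℤ-sub m′ n′)))))
    ; -‿homo = λ (m , n) → trans (⟦⟧ℤ-sub n m) (trans (sym (⁻¹-anti-homo‿- _ _)) (-‿cong (sym (⟦⟧ℤ-sub m n))))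
    ; 0-homo = refl
    ; 1-homo = refl
    }

  _≟ℤ_ : ∀ x y → Maybe (⟦ x ⟧ℤ ≈ ⟦ y ⟧ℤ)
  (m , n) ≟ℤ (m′ , n′) with m ≟ℕ m′ | n ≟ℕ n′
  ... | yes ≡.refl | yes ≡.refl = just refl
  ... | _          | _          = nothing

  open import Algebra.Solver.Ring ℤ-rawRing (ACR.fromCommutativeRing R) homomorphism _≟ℤ_ public
    using (solve; _:=_; _:+_; _:*_; :-_; _:-_; con)

module FieldProperties {c ℓ} (K : Field c ℓ) where
  open Field K
  open ℤ-RingSolver cring
  open import Relation.Binary.Reasoning.Setoid setoid

  _⁻¹⟨_⟩ : ∀ x → ¬ x ≈ 0# → Carrier
  x ⁻¹⟨ x≉0 ⟩ = proj₁ (inverse x x≉0)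

  ⁻¹-inverseʳ : ∀ x (x≉0 : ¬ x ≈ 0#) → x * x ⁻¹⟨ x≉0 ⟩ ≈ 1#
  ⁻¹-inverseʳ x x≉0 = proj₂ (inverse x x≉0)

  ⁻¹-inverseˡ : ∀ x (x≉0 : ¬ x ≈ 0#) → x ⁻¹⟨ x≉0 ⟩ * x ≈ 1#
  ⁻¹-inverseˡ x x≉0 = trans (*-comm _ x) (⁻¹-inverseʳ x x≉0)

  x*y≈0⇒y≈0 : ∀ {x y} → ¬ x ≈ 0# → x * y ≈ 0# → y ≈ 0#
  x*y≈0⇒y≈0 {x} {y} x≉0 xy≈0 = begin
    y                          ≈⟨ *-identityˡ y ⟨
    1# * y                     ≈⟨ *-congʳ (⁻¹-inverseˡ x x≉0) ⟨
    x ⁻¹⟨ x≉0 ⟩ * x * y        ≈⟨ *-assoc _ x y ⟩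
    x ⁻¹⟨ x≉0 ⟩ * (x * y)      ≈⟨ *-congˡ xy≈0 ⟩
    x ⁻¹⟨ x≉0 ⟩ * 0#           ≈⟨ zeroʳ _ ⟩
    0#                         ∎

  *-nonzero : ∀ {x y} → ¬ x ≈ 0# → ¬ y ≈ 0# → ¬ x * y ≈ 0#
  *-nonzero x≉0 y≉0 = y≉0 ∘ x*y≈0⇒y≈0 x≉0

  x*y≈1⇒y²x²z≈z : ∀ {x y} z → x * y ≈ 1# → y * y * (x * x * z) ≈ z
  x*y≈1⇒y²x²z≈z {x} {y} z xy≈1 = begin
    y * y * (x * x * z)       ≈⟨ solve 3 (λ x y z → y :* y :* (x :* x :* z) := (x :* y) :* (x :* y) :* z) refl x y z ⟩
    (x * y) * (x * y) * z     ≈⟨ *-congʳ (*-cong xy≈1 xy≈1) ⟩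
    1# * 1# * z               ≈⟨ solve 1 (λ z → con (1 , 0) :* con (1 , 0) :* z := z) refl z ⟩
    z                         ∎

  x≈y²z⇒y≉0 : ∀ {x y z} → ¬ x ≈ 0# → x ≈ y * y * z → ¬ y ≈ 0#
  x≈y²z⇒y≉0 {x} {y} {z} x≉0 x≈y²z y≈0 = x≉0 (begin
    x              ≈⟨ x≈y²z ⟩
    y * y * z      ≈⟨ *-congʳ (*-cong y≈0 y≈0) ⟩
    0# * 0# * z    ≈⟨ solve 1 (λ z → con (0 , 0) :* con (0 , 0) :* z := con (0 , 0)) refl z ⟩
    0#             ∎)

  x+y≈0∧y≈0⇒x≈0 : ∀ {x y} → x + y ≈ 0# → y ≈ 0# → x ≈ 0#
  x+y≈0∧y≈0⇒x≈0 {x} x+y≈0 y≈0 = trans (sym (+-identityʳ x)) (trans (+-congˡ (sym y≈0)) x+y≈0)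

  x+x≈0⇒x≈0 : ¬ (1# + 1#) ≈ 0# → ∀ {x} → x + x ≈ 0# → x ≈ 0#
  x+x≈0⇒x≈0 2≉0 {x} x+x≈0 =
    x*y≈0⇒y≈0 2≉0 (trans (solve 1 (λ x → (con (1 , 0) :+ con (1 , 0)) :* x := x :+ x) refl x) x+x≈0)

  x≈-x⇒x≈0 : ¬ (1# + 1#) ≈ 0# → ∀ {x} → x ≈ - x → x ≈ 0#
  x≈-x⇒x≈0 2≉0 {x} x≈-x = x+x≈0⇒x≈0 2≉0 (trans (+-congˡ x≈-x) (-‿inverseʳ x))

  x+y≈0∧x-y≈0⇒x≈0∧y≈0 : ¬ (1# + 1#) ≈ 0# → ∀ {x y} → x + y ≈ 0# → x - y ≈ 0# → x ≈ 0# × y ≈ 0#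
  x+y≈0∧x-y≈0⇒x≈0∧y≈0 2≉0 {x} {y} x+y≈0 x-y≈0 =
    x+x≈0⇒x≈0 2≉0 (trans (solve 2 (λ x y → x :+ x := (x :+ y) :+ (x :- y)) refl x y) (sum≈0 x+y≈0 x-y≈0)) ,
    x+x≈0⇒x≈0 2≉0 (trans (solve 2 (λ x y → y :+ y := (x :+ y) :+ :- (x :- y)) refl x y)
                          (sum≈0 x+y≈0 (trans (-‿cong x-y≈0) -0#≈0#)))
    where
    open import Algebra.Properties.Ring ring using (-0#≈0#)
    sum≈0 : ∀ {u v} → u ≈ 0# → v ≈ 0# → u + v ≈ 0#
    sum≈0 u≈0 v≈0 = trans (+-cong u≈0 v≈0) (+-identityˡ 0#)

module ExtensionProperties {c ℓ c′ ℓ′} {F : Field c ℓ} (E : Extension F c′ ℓ′) where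
  open import Data.Vec.Relation.Binary.Pointwise.Inductive as Pointwise using (Pointwise)
  open Extension E public using (L; ι; ι-cong; ι-+; ι-*; ι-1)
  private module F = Field F
  open Field L
  open ℤ-RingSolver cring
  open import Relation.Binary.Reasoning.Setoid setoid

  ι-0# : ι F.0# ≈ 0#
  ι-0# = begin
    ι F.0#                       ≈⟨ solve 1 (λ z → z := z :+ z :- z) refl (ι F.0#) ⟩
    ι F.0# + ι F.0# - ι F.0#     ≈⟨ +-congʳ (ι-+ F.0# F.0#) ⟨
    ι (F.0# F.+ F.0#) - ι F.0#   ≈⟨ +-congʳ (ι-cong (F.+-identityˡ F.0#)) ⟩
    ι F.0# - ι F.0#              ≈⟨ -‿inverseʳ _ ⟩
    0#                           ∎

  ι-‿ : ∀ p → ι (F.- p) ≈ - ι p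
  ι-‿ p = begin
    ι (F.- p)                    ≈⟨ solve 2 (λ x y → x := x :+ y :- y) refl (ι (F.- p)) (ι p) ⟩
    ι (F.- p) + ι p - ι p        ≈⟨ +-congʳ (ι-+ (F.- p) p) ⟨
    ι (F.- p F.+ p) - ι p        ≈⟨ +-congʳ (trans (ι-cong (F.-‿inverseˡ p)) ι-0#) ⟩
    0# - ι p                     ≈⟨ +-identityˡ _ ⟩
    - ι p                        ∎

  ι-sub : ∀ p q → ι (p F.- q) ≈ ι p - ι q
  ι-sub p q = trans (ι-+ p (F.- q)) (+-congˡ (ι-‿ q))

  ι-scaled-square : ∀ {x n} γ → x * x ≈ ι n → (ι γ * x) * (ι γ * x) ≈ ι (γ F.* γ F.* n)
  ι-scaled-square {x} {n} γ x²≈n = begin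
    (ι γ * x) * (ι γ * x)       ≈⟨ solve 2 (λ g x → (g :* x) :* (g :* x) := g :* g :* (x :* x)) refl (ι γ) x ⟩
    ι γ * ι γ * (x * x)         ≈⟨ *-congˡ x²≈n ⟩
    ι γ * ι γ * ι n             ≈⟨ *-congʳ (ι-* γ γ) ⟨
    ι (γ F.* γ) * ι n           ≈⟨ ι-* _ n ⟨
    ι (γ F.* γ F.* n)           ∎

  ι-inverse : ∀ {γ δ} → γ F.* δ F.≈ F.1# → ι γ * ι δ ≈ 1#
  ι-inverse {γ} {δ} γδ≈1 = trans (sym (ι-* γ δ)) (trans (ι-cong γδ≈1) ι-1)

  ι-cancel : ∀ {γ δ} x → γ F.* δ F.≈ F.1# → ι γ * (ι δ * x) ≈ x
  ι-cancel {γ} {δ} x γδ≈1 = begin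
    ι γ * (ι δ * x)        ≈⟨ *-assoc _ _ x ⟨
    ι γ * ι δ * x          ≈⟨ *-congʳ (ι-inverse γδ≈1) ⟩
    1# * x                 ≈⟨ *-identityˡ x ⟩
    x                      ∎

  module EvalF = Expression.Eval F.rawRing {A = F.Carrier} (λ p → p)
  module EvalL = Expression.Eval rawRing {A = F.Carrier} ι

  open import Algebra.Properties.Semiring.Exp.TCOptimised semiring using (_^_; ^-congˡ)
  open import Algebra.Definitions.RawSemiring (Semiring.rawSemiring F.semiring) using () renaming (_^′_ to _^ᶠ_)

  ι-^ : ∀ p n → ι (p ^ᶠ n) ≈ ι p ^ n
  ι-^ p ℕ.zero                = ι-1
  ι-^ p (ℕ.suc ℕ.zero)        = refl
  ι-^ p (ℕ.suc n@(ℕ.suc _))   = trans (ι-* _ p) (*-congʳ (ι-^ p n))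

  ι-eval : ∀ {n} (e : Expr F.Carrier n) {ρ σ} → Pointwise (λ p x → ι p ≈ x) ρ σ → ι (EvalF.⟦ e ⟧ ρ) ≈ EvalL.⟦ e ⟧ σ
  ι-eval (Κ p)   ρ≈σ = refl
  ι-eval (Ι i)   ρ≈σ = Pointwise.lookup ρ≈σ i
  ι-eval (e ⊕ f) ρ≈σ = trans (ι-+ _ _) (+-cong (ι-eval e ρ≈σ) (ι-eval f ρ≈σ))
  ι-eval (e ⊗ f) ρ≈σ = trans (ι-* _ _) (*-cong (ι-eval e ρ≈σ) (ι-eval f ρ≈σ))
  ι-eval (⊝ e)   ρ≈σ = trans (ι-‿ _) (-‿cong (ι-eval e ρ≈σ))
  ι-eval (e ⊛ n) ρ≈σ = trans (ι-^ _ n) (^-congˡ n (ι-eval e ρ≈σ))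

data Line : Set where
  ⟨s⟩ ⟨t⟩ ⟨st⟩ : Line

_≟ᴸ_ : (ℓ ℓ′ : Line) → Dec (ℓ ≡ ℓ′)
⟨s⟩  ≟ᴸ ⟨s⟩  = yes ≡.refl
⟨s⟩  ≟ᴸ ⟨t⟩  = no λ ()
⟨s⟩  ≟ᴸ ⟨st⟩ = no λ ()
⟨t⟩  ≟ᴸ ⟨s⟩  = no λ ()
⟨t⟩  ≟ᴸ ⟨t⟩  = yes ≡.refl
⟨t⟩  ≟ᴸ ⟨st⟩ = no λ ()
⟨st⟩ ≟ᴸ ⟨s⟩  = no λ ()
⟨st⟩ ≟ᴸ ⟨t⟩  = no λ ()
⟨st⟩ ≟ᴸ ⟨st⟩ = yes ≡.refl

another : Line → Line
another ⟨s⟩  = ⟨t⟩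
another ⟨t⟩  = ⟨s⟩
another ⟨st⟩ = ⟨s⟩

another-≢ : ∀ ℓ → another ℓ ≢ ℓ
another-≢ ⟨s⟩  ()
another-≢ ⟨t⟩  ()
another-≢ ⟨st⟩ ()

⟨_,_,_,_⟩ : ∀ {a} {A : Set a} → A → A → A → A → Fin 4 → A
⟨ p , q , r , m ⟩ = lookup (p ∷ q ∷ r ∷ m ∷ [])

module Coordinates {c ℓ} (F : Field c ℓ) where
  open Field F
  private module Eval = Expression.Eval rawRing {A = Carrier} (λ p → p)

  pos : Line → Fin 4
  pos ⟨s⟩  = 1F
  pos ⟨t⟩  = 2F
  pos ⟨st⟩ = 3F

  unit : Line → Fin 4 → Carrier
  unit ⟨s⟩  = ⟨ 0# , 1# , 0# , 0# ⟩
  unit ⟨t⟩  = ⟨ 0# , 0# , 1# , 0# ⟩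
  unit ⟨st⟩ = ⟨ 0# , 0# , 0# , 1# ⟩

  unit-at-pos : ∀ ℓ → unit ℓ (pos ℓ) ≡ 1#
  unit-at-pos ⟨s⟩  = ≡.refl
  unit-at-pos ⟨t⟩  = ≡.refl
  unit-at-pos ⟨st⟩ = ≡.refl

  -- the coordinates of a product, for s² = a and t² = b: variables 0–3 and 4–7 are the factors' coordinates, 8 is a, 9 is b
  productExpr : Fin 4 → Expr Carrier 10
  productExpr = ⟨ c₀ ⊗ d₀ ⊕ a ⊗ (c₁ ⊗ d₁) ⊕ b ⊗ (c₂ ⊗ d₂) ⊕ (a ⊗ b) ⊗ (c₃ ⊗ d₃)
                , c₀ ⊗ d₁ ⊕ c₁ ⊗ d₀ ⊕ b ⊗ (c₂ ⊗ d₃ ⊕ c₃ ⊗ d₂)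
                , c₀ ⊗ d₂ ⊕ c₂ ⊗ d₀ ⊕ a ⊗ (c₁ ⊗ d₃ ⊕ c₃ ⊗ d₁)
                , c₀ ⊗ d₃ ⊕ c₃ ⊗ d₀ ⊕ c₁ ⊗ d₂ ⊕ c₂ ⊗ d₁ ⟩
    where
    c₀ c₁ c₂ c₃ d₀ d₁ d₂ d₃ a b : Expr Carrier 10
    c₀ = Ι 0F ; c₁ = Ι 1F ; c₂ = Ι 2F ; c₃ = Ι 3F
    d₀ = Ι 4F ; d₁ = Ι 5F ; d₂ = Ι 6F ; d₃ = Ι 7F
    a = Ι 8F ; b = Ι 9F

  twist : Line → (Fin 4 → Carrier) → Fin 4 → Carrier
  twist ⟨s⟩  c = ⟨ c 0F , c 1F , - c 2F , - c 3F ⟩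
  twist ⟨t⟩  c = ⟨ c 0F , - c 1F , c 2F , - c 3F ⟩
  twist ⟨st⟩ c = ⟨ c 0F , - c 1F , - c 2F , c 3F ⟩

  twist-negates : ∀ {ℓ ℓ′} → ℓ′ ≢ ℓ → ∀ c → twist ℓ c (pos ℓ′) ≡ - c (pos ℓ′)
  twist-negates {⟨s⟩}  {⟨s⟩}  ℓ′≢ℓ = ⊥-elim (ℓ′≢ℓ ≡.refl)
  twist-negates {⟨s⟩}  {⟨t⟩}  _    c = ≡.refl
  twist-negates {⟨s⟩}  {⟨st⟩} _    c = ≡.refl
  twist-negates {⟨t⟩}  {⟨s⟩}  _    c = ≡.refl
  twist-negates {⟨t⟩}  {⟨t⟩}  ℓ′≢ℓ = ⊥-elim (ℓ′≢ℓ ≡.refl)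
  twist-negates {⟨t⟩}  {⟨st⟩} _    c = ≡.refl
  twist-negates {⟨st⟩} {⟨s⟩}  _    c = ≡.refl
  twist-negates {⟨st⟩} {⟨t⟩}  _    c = ≡.refl
  twist-negates {⟨st⟩} {⟨st⟩} ℓ′≢ℓ = ⊥-elim (ℓ′≢ℓ ≡.refl)

  twist-keeps₀ : ∀ ℓ c → twist ℓ c 0F ≡ c 0F
  twist-keeps₀ ⟨s⟩  c = ≡.refl
  twist-keeps₀ ⟨t⟩  c = ≡.refl
  twist-keeps₀ ⟨st⟩ c = ≡.refl

  product : Carrier → Carrier → (Fin 4 → Carrier) → (Fin 4 → Carrier) → Fin 4 → Carrier
  product a b c d i = Eval.⟦ productExpr i ⟧ (c 0F ∷ c 1F ∷ c 2F ∷ c 3F ∷ d 0F ∷ d 1F ∷ d 2F ∷ d 3F ∷ a ∷ b ∷ [])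

module Combinations {c ℓ c′ ℓ′} {F : Field c ℓ} (E : Extension F c′ ℓ′) where
  private module F = Field F
  open ExtensionProperties E
  open Field L
  open ℤ-RingSolver cring
  open import Data.Vec.Relation.Binary.Pointwise.Inductive using (Pointwise; _∷_; [])
  open Coordinates F public

  lin : (Fin 4 → Carrier) → Carrier → Carrier → Carrier
  lin x s t = x 0F * 1# + (x 1F * s + (x 2F * t + x 3F * (s * t)))

  basis : Carrier → Carrier → Fin 4 → Carrier
  basis s t = ⟨ 1# , s , t , s * t ⟩

  combo : Carrier → Carrier → (Fin 4 → F.Carrier) → Carrier
  combo s t c = lin4 E c (basis s t)

  combo-ι : ∀ {s t c x} → (∀ i → ι (c i) ≈ x i) → combo s t c ≈ lin x s t
  combo-ι c≈x = +-cong (*-congʳ (c≈x 0F))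
    (+-cong (*-congʳ (c≈x 1F)) (+-cong (*-congʳ (c≈x 2F)) (*-congʳ (c≈x 3F))))

  combo-cong : ∀ {s t} c d → (∀ i → c i F.≈ d i) → combo s t c ≈ combo s t d
  combo-cong c d c≈d = combo-ι {c = c} {x = ι ∘ d} (λ i → ι-cong (c≈d i))

  combo-congˢᵗ : ∀ {s s′ t t′} c → s ≈ s′ → t ≈ t′ → combo s t c ≈ combo s′ t′ c
  combo-congˢᵗ c s≈s′ t≈t′ =
    +-congˡ (+-cong (*-congˡ s≈s′) (+-cong (*-congˡ t≈t′) (*-congˡ (*-cong s≈s′ t≈t′))))

  combo-+ : ∀ s t c d → combo s t (λ i → c i F.+ d i) ≈ combo s t c + combo s t d
  combo-+ s t c d = trans (combo-ι (λ i → ι-+ (c i) (d i)))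
    (solve 10 (λ c₀ c₁ c₂ c₃ d₀ d₁ d₂ d₃ s t →
        (c₀ :+ d₀) :* con (1 , 0) :+ ((c₁ :+ d₁) :* s :+ ((c₂ :+ d₂) :* t :+ (c₃ :+ d₃) :* (s :* t)))
     := (c₀ :* con (1 , 0) :+ (c₁ :* s :+ (c₂ :* t :+ c₃ :* (s :* t))))
        :+ (d₀ :* con (1 , 0) :+ (d₁ :* s :+ (d₂ :* t :+ d₃ :* (s :* t)))))
      refl (ι (c 0F)) (ι (c 1F)) (ι (c 2F)) (ι (c 3F)) (ι (d 0F)) (ι (d 1F)) (ι (d 2F)) (ι (d 3F)) s t)

  combo-- : ∀ s t c d → combo s t (λ i → c i F.- d i) ≈ combo s t c - combo s t d
  combo-- s t c d = trans (combo-ι (λ i → ι-sub (c i) (d i)))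
    (solve 10 (λ c₀ c₁ c₂ c₃ d₀ d₁ d₂ d₃ s t →
        (c₀ :- d₀) :* con (1 , 0) :+ ((c₁ :- d₁) :* s :+ ((c₂ :- d₂) :* t :+ (c₃ :- d₃) :* (s :* t)))
     := (c₀ :* con (1 , 0) :+ (c₁ :* s :+ (c₂ :* t :+ c₃ :* (s :* t))))
        :- (d₀ :* con (1 , 0) :+ (d₁ :* s :+ (d₂ :* t :+ d₃ :* (s :* t)))))
      refl (ι (c 0F)) (ι (c 1F)) (ι (c 2F)) (ι (c 3F)) (ι (d 0F)) (ι (d 1F)) (ι (d 2F)) (ι (d 3F)) s t)

  combo-‿ : ∀ s t c → combo s t (λ i → F.- c i) ≈ - combo s t c
  combo-‿ s t c = trans (combo-ι (λ i → ι-‿ (c i)))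
    (solve 6 (λ c₀ c₁ c₂ c₃ s t →
        (:- c₀) :* con (1 , 0) :+ ((:- c₁) :* s :+ ((:- c₂) :* t :+ (:- c₃) :* (s :* t)))
     := :- (c₀ :* con (1 , 0) :+ (c₁ :* s :+ (c₂ :* t :+ c₃ :* (s :* t)))))
      refl (ι (c 0F)) (ι (c 1F)) (ι (c 2F)) (ι (c 3F)) s t)

  combo-const : ∀ s t p → combo s t ⟨ p , F.0# , F.0# , F.0# ⟩ ≈ ι p
  combo-const s t p = trans (combo-ι {c = ⟨ p , F.0# , F.0# , F.0# ⟩} {x = ⟨ ι p , 0# , 0# , 0# ⟩} λ { 0F → refl ; 1F → ι-0# ; 2F → ι-0# ; 3F → ι-0# })
    (solve 3 (λ p s t → p :* con (1 , 0) :+ (con (0 , 0) :* s :+ (con (0 , 0) :* t :+ con (0 , 0) :* (s :* t))) := p)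
      refl (ι p) s t)

  gen : Carrier → Carrier → Line → Carrier
  gen s t ⟨s⟩  = s
  gen s t ⟨t⟩  = t
  gen s t ⟨st⟩ = s * t

  combo-unit : ∀ s t ℓ → combo s t (unit ℓ) ≈ gen s t ℓ
  combo-unit s t ⟨s⟩ = trans
    (combo-ι {c = unit ⟨s⟩} {x = ⟨ 0# , 1# , 0# , 0# ⟩} λ { 0F → ι-0# ; 1F → ι-1 ; 2F → ι-0# ; 3F → ι-0# })
    (solve 2 (λ s t → o :* con (1 , 0) :+ (con (1 , 0) :* s :+ (o :* t :+ o :* (s :* t))) := s) refl s t)
    where o = con (0 , 0)
  combo-unit s t ⟨t⟩ = trans
    (combo-ι {c = unit ⟨t⟩} {x = ⟨ 0# , 0# , 1# , 0# ⟩} λ { 0F → ι-0# ; 1F → ι-0# ; 2F → ι-1 ; 3F → ι-0# })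
    (solve 2 (λ s t → o :* con (1 , 0) :+ (o :* s :+ (con (1 , 0) :* t :+ o :* (s :* t))) := t) refl s t)
    where o = con (0 , 0)
  combo-unit s t ⟨st⟩ = trans
    (combo-ι {c = unit ⟨st⟩} {x = ⟨ 0# , 0# , 0# , 1# ⟩} λ { 0F → ι-0# ; 1F → ι-0# ; 2F → ι-0# ; 3F → ι-1 })
    (solve 2 (λ s t → o :* con (1 , 0) :+ (o :* s :+ (o :* t :+ con (1 , 0) :* (s :* t))) := s :* t) refl s t)
    where o = con (0 , 0)

  combo-product : ∀ {s t a b} → s * s ≈ ι a → t * t ≈ ι b →
                  ∀ c d → combo s t (product a b c d) ≈ combo s t c * combo s t d
  combo-product {s} {t} {a} {b} s²≈a t²≈b c d = trans
    (combo-ι {c = product a b c d} {x = λ i → EvalL.⟦ productExpr i ⟧ σ}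
      (λ i → ι-eval (productExpr i) (refl ∷ refl ∷ refl ∷ refl ∷ refl ∷ refl ∷ refl ∷ refl ∷ sym s²≈a ∷ sym t²≈b ∷ [])))
    (solve 10 (λ c₀ c₁ c₂ c₃ d₀ d₁ d₂ d₃ s t →
         (c₀ :* d₀ :+ (s :* s) :* (c₁ :* d₁) :+ (t :* t) :* (c₂ :* d₂) :+ ((s :* s) :* (t :* t)) :* (c₃ :* d₃)) :* con (1 , 0)
      :+ ((c₀ :* d₁ :+ c₁ :* d₀ :+ (t :* t) :* (c₂ :* d₃ :+ c₃ :* d₂)) :* s
      :+ ((c₀ :* d₂ :+ c₂ :* d₀ :+ (s :* s) :* (c₁ :* d₃ :+ c₃ :* d₁)) :* t
      :+  (c₀ :* d₃ :+ c₃ :* d₀ :+ c₁ :* d₂ :+ c₂ :* d₁) :* (s :* t)))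
      := (c₀ :* con (1 , 0) :+ (c₁ :* s :+ (c₂ :* t :+ c₃ :* (s :* t))))
      :* (d₀ :* con (1 , 0) :+ (d₁ :* s :+ (d₂ :* t :+ d₃ :* (s :* t)))))
      refl (ι (c 0F)) (ι (c 1F)) (ι (c 2F)) (ι (c 3F)) (ι (d 0F)) (ι (d 1F)) (ι (d 2F)) (ι (d 3F)) s t)
    where
    σ : Vec Carrier 10
    σ = ι (c 0F) ∷ ι (c 1F) ∷ ι (c 2F) ∷ ι (c 3F) ∷ ι (d 0F) ∷ ι (d 1F) ∷ ι (d 2F) ∷ ι (d 3F) ∷ s * s ∷ t * t ∷ []

record FHom {c ℓ c₁ ℓ₁ c₂ ℓ₂} {F : Field c ℓ} (E₁ : Extension F c₁ ℓ₁) (E₂ : Extension F c₂ ℓ₂)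
            : Set (c ⊔ c₁ ⊔ ℓ₁ ⊔ c₂ ⊔ ℓ₂) where
  private
    module L₁ = Field (Extension.L E₁)
    module L₂ = Field (Extension.L E₂)
  field
    to      : L₁.Carrier → L₂.Carrier
    cong    : ∀ {x y} → x L₁.≈ y → to x L₂.≈ to y
    +-homo  : ∀ x y → to (x L₁.+ y) L₂.≈ to x L₂.+ to y
    *-homo  : ∀ x y → to (x L₁.* y) L₂.≈ to x L₂.* to y
    1#-homo : to L₁.1# L₂.≈ L₂.1#
    ι-homo  : ∀ p → to (Extension.ι E₁ p) L₂.≈ Extension.ι E₂ p

module _ {c ℓ} {F : Field c ℓ} where

  idᴴ : ∀ {c′ ℓ′} {E : Extension F c′ ℓ′} → FHom E E
  idᴴ {E = E} = record
    { to = λ x → x ; cong = λ x≈y → x≈y ; +-homo = λ _ _ → refl ; *-homo = λ _ _ → refl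
    ; 1#-homo = refl ; ι-homo = λ _ → refl }
    where open Field (Extension.L E) using (refl)

  _∘ᴴ_ : ∀ {c₁ ℓ₁ c₂ ℓ₂ c₃ ℓ₃} {E₁ : Extension F c₁ ℓ₁} {E₂ : Extension F c₂ ℓ₂} {E₃ : Extension F c₃ ℓ₃} →
         FHom E₂ E₃ → FHom E₁ E₂ → FHom E₁ E₃
  _∘ᴴ_ {E₃ = E₃} ψ φ = record
    { to      = λ x → ψ.to (φ.to x)
    ; cong    = λ x≈y → ψ.cong (φ.cong x≈y)
    ; +-homo  = λ x y → trans (ψ.cong (φ.+-homo x y)) (ψ.+-homo _ _)
    ; *-homo  = λ x y → trans (ψ.cong (φ.*-homo x y)) (ψ.*-homo _ _)
    ; 1#-homo = trans (ψ.cong φ.1#-homo) ψ.1#-homo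
    ; ι-homo  = λ p → trans (ψ.cong (φ.ι-homo p)) (ψ.ι-homo p) }
    where
    module φ = FHom φ
    module ψ = FHom ψ
    open Field (Extension.L E₃) using (trans)

module FHomProperties {c ℓ c₁ ℓ₁ c₂ ℓ₂} {F : Field c ℓ} {E₁ : Extension F c₁ ℓ₁} {E₂ : Extension F c₂ ℓ₂}
                      (φ : FHom E₁ E₂) where
  open FHom φ
  private
    module F = Field F
    module L₁ = Field (Extension.L E₁)
    module E₁ = ExtensionProperties E₁
    module C₁ = Combinations E₁
  open Field (Extension.L E₂)
  open ExtensionProperties E₂ using (ι; ι-0#)
  open Combinations E₂ using (combo)
  open ℤ-RingSolver cring
  open import Relation.Binary.Reasoning.Setoid setoid

  0#-homo : to L₁.0# ≈ 0#
  0#-homo = trans (cong (L₁.sym E₁.ι-0#)) (trans (ι-homo F.0#) ι-0#)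

  -‿homo : ∀ x → to (L₁.- x) ≈ - to x
  -‿homo x = begin
    to (L₁.- x)                  ≈⟨ solve 2 (λ y z → y := y :+ z :- z) refl (to (L₁.- x)) (to x) ⟩
    to (L₁.- x) + to x - to x    ≈⟨ +-congʳ (+-homo (L₁.- x) x) ⟨
    to (L₁.- x L₁.+ x) - to x    ≈⟨ +-congʳ (trans (cong (L₁.-‿inverseˡ x)) 0#-homo) ⟩
    0# - to x                    ≈⟨ +-identityˡ _ ⟩
    - to x                       ∎

  scalar-homo : ∀ γ x → to (E₁.ι γ L₁.* x) ≈ ι γ * to x
  scalar-homo γ x = trans (*-homo _ x) (*-congʳ (ι-homo γ))

  combo-homo : ∀ s t c → to (C₁.combo s t c) ≈ combo (to s) (to t) c
  combo-homo s t c = trans (+-homo _ _) (+-cong (trans (*-homo _ _) (*-cong (ι-homo _) 1#-homo))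
    (trans (+-homo _ _) (+-cong (scalar-homo _ s) (trans (+-homo _ _) (+-cong (scalar-homo _ t)
      (trans (scalar-homo _ _) (*-congˡ (*-homo s t))))))))

record BiquadraticBasis {c ℓ c′ ℓ′} {F : Field c ℓ} (E : Extension F c′ ℓ′) : Set (c ⊔ ℓ ⊔ c′ ⊔ ℓ′) where
  private
    module F = Field F
  open Field (Extension.L E)
  open Extension E using (ι)
  open Combinations E using (basis)
  field
    s t         : Carrier
    a b         : F.Carrier
    s²≈a        : s * s ≈ ι a
    t²≈b        : t * t ≈ ι b
    spans       : Spans4 E (basis s t)
    independent : Independent4 E (basis s t)

module BasisProperties {c ℓ c′ ℓ′} {F : Field c ℓ} {E : Extension F c′ ℓ′} (Q : BiquadraticBasis E) where
  open BiquadraticBasis Q public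
  private
    module F = Field F
  open Field (Extension.L E)
  open ExtensionProperties E
  open Combinations E
  open import Algebra.Properties.AbelianGroup F.+-abelianGroup using (x∙y⁻¹≈ε⇒x≈y)
  open import Algebra.Properties.AbelianGroup +-abelianGroup using (x≈y⇒x∙y⁻¹≈ε)

  coords : Carrier → Fin 4 → F.Carrier
  coords x = proj₁ (spans x)

  coords-sound : ∀ x → x ≈ combo s t (coords x)
  coords-sound x = proj₂ (spans x)

  combo-injective : ∀ c d → combo s t c ≈ combo s t d → ∀ i → c i F.≈ d i
  combo-injective c d c≈d i =
    x∙y⁻¹≈ε⇒x≈y _ _ (independent (λ j → c j F.- d j) (trans (combo-- s t c d) (x≈y⇒x∙y⁻¹≈ε c≈d)) i)

  coords-unique : ∀ {x} c → x ≈ combo s t c → ∀ i → coords x i F.≈ c i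
  coords-unique {x} c x≈c = combo-injective (coords x) c (trans (sym (coords-sound x)) x≈c)

  ι-injective : ∀ {p q} → ι p ≈ ι q → p F.≈ q
  ι-injective {p} {q} ιp≈ιq =
    combo-injective ⟨ p , F.0# , F.0# , F.0# ⟩ ⟨ q , F.0# , F.0# , F.0# ⟩ (trans (combo-const s t p) (trans ιp≈ιq (sym (combo-const s t q)))) 0F

  L-2≉0 : CharNot2 F → ¬ (1# + 1#) ≈ 0#
  L-2≉0 2≉0 2≈0 = 2≉0 (ι-injective (trans (ι-+ _ _) (trans (+-cong ι-1 ι-1) (trans 2≈0 (sym ι-0#)))))

  square : Line → F.Carrier
  square ⟨s⟩  = a
  square ⟨t⟩  = b
  square ⟨st⟩ = a F.* b

  gen² : ∀ ℓ → gen s t ℓ * gen s t ℓ ≈ ι (square ℓ)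
  gen² ⟨s⟩  = s²≈a
  gen² ⟨t⟩  = t²≈b
  gen² ⟨st⟩ = begin
    (s * t) * (s * t)    ≈⟨ solve 2 (λ s t → (s :* t) :* (s :* t) := (s :* s) :* (t :* t)) refl s t ⟩
    (s * s) * (t * t)    ≈⟨ *-cong s²≈a t²≈b ⟩
    ι a * ι b            ≈⟨ ι-* a b ⟨
    ι (a F.* b)          ∎
    where
    open ℤ-RingSolver cring
    open import Relation.Binary.Reasoning.Setoid setoid

  gen≉0 : ∀ ℓ → ¬ gen s t ℓ ≈ 0#
  gen≉0 ℓ g≈0 = F.1≉0 (F.trans (F.reflexive (≡.sym (unit-at-pos ℓ)))
    (independent (unit ℓ) (trans (combo-unit s t ℓ) g≈0) (pos ℓ)))

  square≉0 : ∀ ℓ → ¬ square ℓ F.≈ F.0#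
  square≉0 ℓ sq≈0 = *-nonzero (gen≉0 ℓ) (gen≉0 ℓ) (trans (gen² ℓ) (trans (ι-cong sq≈0) ι-0#))
    where open FieldProperties (Extension.L E) using (*-nonzero)

  SquaresOnLines : F.Carrier → F.Carrier → Line → Line → Set (c ⊔ ℓ)
  SquaresOnLines a′ b′ ℓ₁ ℓ₂ = SquareQuot F b′ (square ℓ₁) × SquareQuot F a′ (square ℓ₂)

  module _ {c″ ℓ″} {E′ : Extension F c″ ℓ″} where
    private
      module L′ = Field (Extension.L E′)
      module X′ = ExtensionProperties E′
      module C′ = Combinations E′

    private
      coords-image : ∀ {S T x} c → x ≈ combo s t c → C′.combo S T (coords x) L′.≈ C′.combo S T c
      coords-image {x = x} c x≈c = C′.combo-cong (coords x) c (coords-unique c x≈c)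

    opaque
      lift : ∀ {S T} → S L′.* S L′.≈ X′.ι a → T L′.* T L′.≈ X′.ι b → FHom E E′
      lift {S} {T} S²≈a T²≈b = record
        { to      = λ x → C′.combo S T (coords x)
        ; cong    = λ {x} {y} x≈y → coords-image (coords y) (trans x≈y (coords-sound y))
        ; +-homo  = λ x y → L′.trans
            (coords-image (λ i → coords x i F.+ coords y i)
              (trans (+-cong (coords-sound x) (coords-sound y)) (sym (combo-+ s t (coords x) (coords y)))))
            (C′.combo-+ S T (coords x) (coords y))
        ; *-homo  = λ x y → L′.trans
            (coords-image (product a b (coords x) (coords y))
              (trans (*-cong (coords-sound x) (coords-sound y)) (sym (combo-product s²≈a t²≈b (coords x) (coords y)))))
            (C′.combo-product S²≈a T²≈b (coords x) (coords y))
        ; 1#-homo = L′.trans (coords-image ⟨ F.1# , F.0# , F.0# , F.0# ⟩ (trans (sym ι-1) (sym (combo-const s t F.1#))))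
                             (L′.trans (C′.combo-const S T F.1#) X′.ι-1)
        ; ι-homo  = λ p → L′.trans (coords-image ⟨ p , F.0# , F.0# , F.0# ⟩ (sym (combo-const s t p)))
                                   (C′.combo-const S T p)
        }

      lift-apply : ∀ {S T} (S²≈a : S L′.* S L′.≈ X′.ι a) (T²≈b : T L′.* T L′.≈ X′.ι b) x →
                   FHom.to (lift S²≈a T²≈b) x L′.≈ C′.combo S T (coords x)
      lift-apply _ _ _ = L′.refl

      lift-gen : ∀ {S T} (S²≈a : S L′.* S L′.≈ X′.ι a) (T²≈b : T L′.* T L′.≈ X′.ι b) ℓ →
                 FHom.to (lift S²≈a T²≈b) (gen s t ℓ) L′.≈ C′.gen S T ℓ
      lift-gen {S} {T} _ _ ℓ = L′.trans (coords-image (unit ℓ) (sym (combo-unit s t ℓ))) (C′.combo-unit S T ℓ)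

    FHom-ext : (φ ψ : FHom E E′) → FHom.to φ s L′.≈ FHom.to ψ s → FHom.to φ t L′.≈ FHom.to ψ t →
               ∀ x → FHom.to φ x L′.≈ FHom.to ψ x
    FHom-ext φ ψ φs≈ψs φt≈ψt x = begin
      φ.to x                                     ≈⟨ φ.cong (coords-sound x) ⟩
      φ.to (combo s t (coords x))                ≈⟨ combo-homo φ s t (coords x) ⟩
      C′.combo (φ.to s) (φ.to t) (coords x)      ≈⟨ C′.combo-congˢᵗ (coords x) φs≈ψs φt≈ψt ⟩
      C′.combo (ψ.to s) (ψ.to t) (coords x)      ≈⟨ combo-homo ψ s t (coords x) ⟨
      ψ.to (combo s t (coords x))                ≈⟨ ψ.cong (coords-sound x) ⟨
      ψ.to x                                     ∎
      where
      module φ = FHom φ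
      module ψ = FHom ψ
      open FHomProperties using (combo-homo)
      open import Relation.Binary.Reasoning.Setoid L′.setoid

FHom⇒IsFHom : ∀ {c ℓ c′ ℓ′} {F : Field c ℓ} {E : Extension F c′ ℓ′} (φ : FHom E E) → IsFHom E (FHom.to φ)
FHom⇒IsFHom φ = FHom.cong φ , FHom.+-homo φ , FHom.*-homo φ , FHom.1#-homo φ , FHom.ι-homo φ

module Reflections {f ℓ f′ ℓ′} {F : Field f ℓ} (2≉0 : CharNot2 F) {E : Extension F f′ ℓ′}
                   (Q : BiquadraticBasis E) where
  open BasisProperties Q
  private
    module F = Field F
  open Field (Extension.L E)
  open ExtensionProperties E
  open Combinations E
  open FieldProperties F using (x≈-x⇒x≈0)
  open ℤ-RingSolver cring
  open import Relation.Binary.Reasoning.Setoid setoid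

  private
    -x²≈x² : ∀ {x n} → x * x ≈ ι n → - x * - x ≈ ι n
    -x²≈x² {x} x²≈n = trans (solve 1 (λ x → :- x :* :- x := x :* x) refl x) x²≈n

    vanish : ∀ {p} → p F.≈ F.0# → ι p ≈ 0#
    vanish p≈0 = trans (ι-cong p≈0) ι-0#

  image-s image-t : Line → Carrier
  image-s ⟨s⟩ = s
  image-s _   = - s
  image-t ⟨t⟩ = t
  image-t _   = - t

  image-s² : ∀ ℓ → image-s ℓ * image-s ℓ ≈ ι a
  image-s² ⟨s⟩  = s²≈a
  image-s² ⟨t⟩  = -x²≈x² s²≈a
  image-s² ⟨st⟩ = -x²≈x² s²≈a

  image-t² : ∀ ℓ → image-t ℓ * image-t ℓ ≈ ι b
  image-t² ⟨s⟩  = -x²≈x² t²≈b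
  image-t² ⟨t⟩  = t²≈b
  image-t² ⟨st⟩ = -x²≈x² t²≈b

  reflection : Line → FHom E E
  reflection ℓ = lift {E′ = E} (image-s² ℓ) (image-t² ℓ)

  ρ⟨_⟩ : Line → Carrier → Carrier
  ρ⟨ ℓ ⟩ = FHom.to (reflection ℓ)

  reflection-apply : ∀ ℓ x → ρ⟨ ℓ ⟩ x ≈ combo (image-s ℓ) (image-t ℓ) (coords x)
  reflection-apply ℓ = lift-apply {E′ = E} (image-s² ℓ) (image-t² ℓ)

  reflection-gen : ∀ ℓ ℓ′ → ρ⟨ ℓ ⟩ (gen s t ℓ′) ≈ gen (image-s ℓ) (image-t ℓ) ℓ′
  reflection-gen ℓ = lift-gen {E′ = E} (image-s² ℓ) (image-t² ℓ)

  reflection-coords : ∀ ℓ x → ρ⟨ ℓ ⟩ x ≈ combo s t (twist ℓ (coords x))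
  reflection-coords ⟨s⟩ x = trans (reflection-apply ⟨s⟩ x) (sym (trans
    (combo-ι {c = twist ⟨s⟩ c} {x = ⟨ ι (c 0F) , ι (c 1F) , - ι (c 2F) , - ι (c 3F) ⟩}
      λ { 0F → refl ; 1F → refl ; 2F → ι-‿ _ ; 3F → ι-‿ _ })
    (solve 6 (λ c₀ c₁ c₂ c₃ s t →
        c₀ :* con (1 , 0) :+ (c₁ :* s :+ ((:- c₂) :* t :+ (:- c₃) :* (s :* t)))
     := c₀ :* con (1 , 0) :+ (c₁ :* s :+ (c₂ :* :- t :+ c₃ :* (s :* :- t))))
      refl (ι (c 0F)) (ι (c 1F)) (ι (c 2F)) (ι (c 3F)) s t)))
    where c = coords x
  reflection-coords ⟨t⟩ x = trans (reflection-apply ⟨t⟩ x) (sym (trans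
    (combo-ι {c = twist ⟨t⟩ c} {x = ⟨ ι (c 0F) , - ι (c 1F) , ι (c 2F) , - ι (c 3F) ⟩}
      λ { 0F → refl ; 1F → ι-‿ _ ; 2F → refl ; 3F → ι-‿ _ })
    (solve 6 (λ c₀ c₁ c₂ c₃ s t →
        c₀ :* con (1 , 0) :+ ((:- c₁) :* s :+ (c₂ :* t :+ (:- c₃) :* (s :* t)))
     := c₀ :* con (1 , 0) :+ (c₁ :* :- s :+ (c₂ :* t :+ c₃ :* (:- s :* t))))
      refl (ι (c 0F)) (ι (c 1F)) (ι (c 2F)) (ι (c 3F)) s t)))
    where c = coords x
  reflection-coords ⟨st⟩ x = trans (reflection-apply ⟨st⟩ x) (sym (trans
    (combo-ι {c = twist ⟨st⟩ c} {x = ⟨ ι (c 0F) , - ι (c 1F) , - ι (c 2F) , ι (c 3F) ⟩}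
      λ { 0F → refl ; 1F → ι-‿ _ ; 2F → ι-‿ _ ; 3F → refl })
    (solve 6 (λ c₀ c₁ c₂ c₃ s t →
        c₀ :* con (1 , 0) :+ ((:- c₁) :* s :+ ((:- c₂) :* t :+ c₃ :* (s :* t)))
     := c₀ :* con (1 , 0) :+ (c₁ :* :- s :+ (c₂ :* :- t :+ c₃ :* (:- s :* :- t))))
      refl (ι (c 0F)) (ι (c 1F)) (ι (c 2F)) (ι (c 3F)) s t)))
    where c = coords x

  reflection-fixes : ∀ ℓ → ρ⟨ ℓ ⟩ (gen s t ℓ) ≈ gen s t ℓ
  reflection-fixes ⟨s⟩  = reflection-gen ⟨s⟩ ⟨s⟩
  reflection-fixes ⟨t⟩  = reflection-gen ⟨t⟩ ⟨t⟩
  reflection-fixes ⟨st⟩ = trans (reflection-gen ⟨st⟩ ⟨st⟩) (solve 2 (λ s t → :- s :* :- t := s :* t) refl s t)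

  reflection-negates : ∀ {ℓ ℓ′} → ℓ′ ≢ ℓ → ρ⟨ ℓ ⟩ (gen s t ℓ′) ≈ - gen s t ℓ′
  reflection-negates {⟨s⟩}  {⟨s⟩}  ℓ′≢ℓ = ⊥-elim (ℓ′≢ℓ ≡.refl)
  reflection-negates {⟨s⟩}  {⟨t⟩}  _ = reflection-gen ⟨s⟩ ⟨t⟩
  reflection-negates {⟨s⟩}  {⟨st⟩} _ = trans (reflection-gen ⟨s⟩ ⟨st⟩) (solve 2 (λ s t → s :* :- t := :- (s :* t)) refl s t)
  reflection-negates {⟨t⟩}  {⟨s⟩}  _ = reflection-gen ⟨t⟩ ⟨s⟩
  reflection-negates {⟨t⟩}  {⟨t⟩}  ℓ′≢ℓ = ⊥-elim (ℓ′≢ℓ ≡.refl)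
  reflection-negates {⟨t⟩}  {⟨st⟩} _ = trans (reflection-gen ⟨t⟩ ⟨st⟩) (solve 2 (λ s t → :- s :* t := :- (s :* t)) refl s t)
  reflection-negates {⟨st⟩} {⟨s⟩}  _ = reflection-gen ⟨st⟩ ⟨s⟩
  reflection-negates {⟨st⟩} {⟨t⟩}  _ = reflection-gen ⟨st⟩ ⟨t⟩
  reflection-negates {⟨st⟩} {⟨st⟩} ℓ′≢ℓ = ⊥-elim (ℓ′≢ℓ ≡.refl)

  reflection-involutive : ∀ ℓ x → ρ⟨ ℓ ⟩ (ρ⟨ ℓ ⟩ x) ≈ x
  reflection-involutive ℓ = FHom-ext (reflection ℓ ∘ᴴ reflection ℓ) idᴴ (twice ⟨s⟩) (twice ⟨t⟩)
    where
    open FHom (reflection ℓ) using (cong)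
    open FHomProperties (reflection ℓ) using (-‿homo)
    open import Algebra.Properties.Ring ring using (-‿involutive)
    twice : ∀ ℓ′ → ρ⟨ ℓ ⟩ (ρ⟨ ℓ ⟩ (gen s t ℓ′)) ≈ gen s t ℓ′
    twice ℓ′ with ℓ′ ≟ᴸ ℓ
    ... | yes ≡.refl = trans (cong (reflection-fixes ℓ)) (reflection-fixes ℓ)
    ... | no ℓ′≢ℓ    = begin
      ρ⟨ ℓ ⟩ (ρ⟨ ℓ ⟩ (gen s t ℓ′))   ≈⟨ cong (reflection-negates ℓ′≢ℓ) ⟩
      ρ⟨ ℓ ⟩ (- gen s t ℓ′)          ≈⟨ -‿homo _ ⟩
      - ρ⟨ ℓ ⟩ (gen s t ℓ′)          ≈⟨ -‿cong (reflection-negates ℓ′≢ℓ) ⟩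
      - - gen s t ℓ′                 ≈⟨ -‿involutive _ ⟩
      gen s t ℓ′                     ∎

  reflection-isFAut : ∀ ℓ → IsFAut E ρ⟨ ℓ ⟩
  reflection-isFAut ℓ = FHom⇒IsFHom (reflection ℓ) , ρ⟨ ℓ ⟩ , FHom⇒IsFHom (reflection ℓ)
                      , reflection-involutive ℓ , reflection-involutive ℓ

  gen≉-gen : ∀ ℓ → ¬ gen s t ℓ ≈ - gen s t ℓ
  gen≉-gen ℓ = gen≉0 ℓ ∘ FieldProperties.x≈-x⇒x≈0 (Extension.L E) (L-2≉0 2≉0)

  reflection-nontrivial : ∀ ℓ → ¬ (∀ x → ρ⟨ ℓ ⟩ x ≈ x)
  reflection-nontrivial ℓ ρ≈id =
    gen≉-gen (another ℓ) (trans (sym (ρ≈id _)) (reflection-negates (another-≢ ℓ)))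

  reflection-injective : ∀ {ℓ ℓ′} → (∀ x → ρ⟨ ℓ ⟩ x ≈ ρ⟨ ℓ′ ⟩ x) → ℓ ≡ ℓ′
  reflection-injective {ℓ} {ℓ′} ρ≈ρ′ with ℓ ≟ᴸ ℓ′
  ... | yes ℓ≡ℓ′ = ℓ≡ℓ′
  ... | no ℓ≢ℓ′  = ⊥-elim (gen≉-gen ℓ (trans (sym (reflection-fixes ℓ)) (trans (ρ≈ρ′ _) (reflection-negates ℓ≢ℓ′))))

  fixed⇒off-line-coords≈0 : ∀ {ℓ X} → ρ⟨ ℓ ⟩ X ≈ X → ∀ ℓ′ → ℓ′ ≢ ℓ → coords X (pos ℓ′) F.≈ F.0#
  fixed⇒off-line-coords≈0 {ℓ} {X} ρX≈X ℓ′ ℓ′≢ℓ = x≈-x⇒x≈0 2≉0 (F.sym (F.trans (F.reflexive (≡.sym (twist-negates ℓ′≢ℓ c)))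
    (combo-injective (twist ℓ c) c (trans (sym (reflection-coords ℓ X)) (trans ρX≈X (coords-sound X))) (pos ℓ′))))
    where c = coords X

  negated⇒coord₀≈0 : ∀ {ℓ X} → ρ⟨ ℓ ⟩ X ≈ - X → coords X 0F F.≈ F.0#
  negated⇒coord₀≈0 {ℓ} {X} ρX≈-X = x≈-x⇒x≈0 2≉0 (F.trans (F.reflexive (≡.sym (twist-keeps₀ ℓ c)))
    (combo-injective (twist ℓ c) (λ i → F.- c i)
      (trans (sym (reflection-coords ℓ X)) (trans ρX≈-X (trans (-‿cong (coords-sound X)) (sym (combo-‿ s t c))))) 0F))
    where c = coords X

  on-line : ∀ ℓ c → c 0F F.≈ F.0# → (∀ ℓ′ → ℓ′ ≢ ℓ → c (pos ℓ′) F.≈ F.0#) →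
            combo s t c ≈ ι (c (pos ℓ)) * gen s t ℓ
  on-line ⟨s⟩ c c₀≈0 off≈0 = trans
    (combo-ι {c = c} {x = ⟨ 0# , ι (c 1F) , 0# , 0# ⟩}
      λ { 0F → vanish c₀≈0 ; 1F → refl ; 2F → vanish (off≈0 ⟨t⟩ λ ()) ; 3F → vanish (off≈0 ⟨st⟩ λ ()) })
    (solve 3 (λ q s t → con (0 , 0) :* con (1 , 0) :+ (q :* s :+ (con (0 , 0) :* t :+ con (0 , 0) :* (s :* t))) := q :* s) refl (ι (c 1F)) s t)
  on-line ⟨t⟩ c c₀≈0 off≈0 = trans
    (combo-ι {c = c} {x = ⟨ 0# , 0# , ι (c 2F) , 0# ⟩}
      λ { 0F → vanish c₀≈0 ; 1F → vanish (off≈0 ⟨s⟩ λ ()) ; 2F → refl ; 3F → vanish (off≈0 ⟨st⟩ λ ()) })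
    (solve 3 (λ q s t → con (0 , 0) :* con (1 , 0) :+ (con (0 , 0) :* s :+ (q :* t :+ con (0 , 0) :* (s :* t))) := q :* t) refl (ι (c 2F)) s t)
  on-line ⟨st⟩ c c₀≈0 off≈0 = trans
    (combo-ι {c = c} {x = ⟨ 0# , 0# , 0# , ι (c 3F) ⟩}
      λ { 0F → vanish c₀≈0 ; 1F → vanish (off≈0 ⟨s⟩ λ ()) ; 2F → vanish (off≈0 ⟨t⟩ λ ()) ; 3F → refl })
    (solve 3 (λ q s t → con (0 , 0) :* con (1 , 0) :+ (con (0 , 0) :* s :+ (con (0 , 0) :* t :+ q :* (s :* t))) := q :* (s :* t)) refl (ι (c 3F)) s t)

  eigenvector-on-line : ∀ {ℓ ℓ′ X} → ρ⟨ ℓ ⟩ X ≈ X → ρ⟨ ℓ′ ⟩ X ≈ - X → X ≈ ι (coords X (pos ℓ)) * gen s t ℓ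
  eigenvector-on-line {ℓ} {ℓ′} {X} fixed negated = trans (coords-sound X)
    (on-line ℓ (coords X) (negated⇒coord₀≈0 {ℓ′} negated) (fixed⇒off-line-coords≈0 {ℓ} fixed))

  eigenvector-square-class : ∀ {ℓ ℓ′ X n} → ρ⟨ ℓ ⟩ X ≈ X → ρ⟨ ℓ′ ⟩ X ≈ - X → X * X ≈ ι n →
                             SquareQuot F n (square ℓ)
  eigenvector-square-class {ℓ} {ℓ′} {X} {n} fixed negated X²≈n = square≉0 ℓ , q , ι-injective (begin
    ι n                                        ≈⟨ X²≈n ⟨
    X * X                                      ≈⟨ *-cong X≈qg X≈qg ⟩
    (ι q * gen s t ℓ) * (ι q * gen s t ℓ)      ≈⟨ ι-scaled-square q (gen² ℓ) ⟩
    ι (q F.* q F.* square ℓ)                   ∎)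
    where
    q = coords X (pos ℓ)
    X≈qg = eigenvector-on-line {ℓ} {ℓ′} fixed negated

module _ {a r} (S : Setoid a r) where
  open Setoid S

  module _ (x : Line → Carrier) (injective : ∀ {ℓ ℓ′} → x ℓ ≈ x ℓ′ → ℓ ≡ ℓ′) where

    private
      collide : ∀ {ℓ ℓ′ y} → x ℓ ≈ y → x ℓ′ ≈ y → ℓ ≡ ℓ′
      collide e e′ = injective (trans e (sym e′))

    hit-by-some-line : ∀ {g h k} → (∀ ℓ → x ℓ ≈ g ⊎ x ℓ ≈ h ⊎ x ℓ ≈ k) → ∃ λ ℓ → x ℓ ≈ g
    hit-by-some-line hit with hit ⟨s⟩ | hit ⟨t⟩ | hit ⟨st⟩
    ... | inj₁ e | _      | _      = ⟨s⟩ , e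
    ... | _      | inj₁ e | _      = ⟨t⟩ , e
    ... | _      | _      | inj₁ e = ⟨st⟩ , e
    ... | inj₂ (inj₁ e₁) | inj₂ (inj₁ e₂) | _              = case collide e₁ e₂ of λ ()
    ... | inj₂ (inj₂ e₁) | inj₂ (inj₂ e₂) | _              = case collide e₁ e₂ of λ ()
    ... | inj₂ (inj₁ e₁) | inj₂ (inj₂ _)  | inj₂ (inj₁ e₃) = case collide e₁ e₃ of λ ()
    ... | inj₂ (inj₁ _)  | inj₂ (inj₂ e₂) | inj₂ (inj₂ e₃) = case collide e₂ e₃ of λ ()
    ... | inj₂ (inj₂ _)  | inj₂ (inj₁ e₂) | inj₂ (inj₁ e₃) = case collide e₂ e₃ of λ ()
    ... | inj₂ (inj₂ e₁) | inj₂ (inj₁ _)  | inj₂ (inj₂ e₃) = case collide e₁ e₃ of λ ()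

module Automorphisms {f ℓ f′ ℓ′} {F : Field f ℓ} (2≉0 : CharNot2 F) {E : Extension F f′ ℓ′}
                     (Q : BiquadraticBasis E) where
  open Reflections 2≉0 Q
  open BasisProperties Q using (SquaresOnLines)
  open Field (Extension.L E)

  private
    _≗_ : (Carrier → Carrier) → (Carrier → Carrier) → Set (f′ ⊔ ℓ′)
    σ ≗ τ = ∀ x → σ x ≈ τ x

    endomaps : Setoid f′ (f′ ⊔ ℓ′)
    endomaps = record
      { Carrier = Carrier → Carrier ; _≈_ = _≗_
      ; isEquivalence = record
        { refl = λ _ → refl ; sym = λ σ≗τ x → sym (σ≗τ x) ; trans = λ σ≗τ τ≗υ x → trans (σ≗τ x) (τ≗υ x) } }

  -- the automorphism group is given abstractly; matching it with the reflections is what makes the case split constructive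
  automorphism-classification : IsElementaryAbelian E → ∀ {ρ} → IsFAut E ρ → ρ ≗ (λ x → x) ⊎ ∃ λ ℓ → ρ ≗ ρ⟨ ℓ ⟩
  automorphism-classification (_ , σ , τ , _ , _ , _ , _ , _ , _ , _ , _ , _ , _ , _ , classify) {ρ} ρ-aut =
    case classify ρ ρ-aut of λ where
      (inj₁ ρ≗id)               → inj₁ ρ≗id
      (inj₂ (inj₁ ρ≗σ))         → inj₂ (via ρ≗σ (hit-by-some-line endomaps ρ⟨_⟩ inj hits))
      (inj₂ (inj₂ (inj₁ ρ≗τ)))  → inj₂ (via ρ≗τ (hit-by-some-line endomaps ρ⟨_⟩ inj
                                     (λ ℓ → [ inj₂ ∘ inj₁ , [ inj₁ , inj₂ ∘ inj₂ ]′ ]′ (hits ℓ))))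
      (inj₂ (inj₂ (inj₂ ρ≗στ))) → inj₂ (via ρ≗στ (hit-by-some-line endomaps ρ⟨_⟩ inj
                                     (λ ℓ → [ inj₂ ∘ inj₁ , [ inj₂ ∘ inj₂ , inj₁ ]′ ]′ (hits ℓ))))
    where
    στ : Carrier → Carrier
    στ x = σ (τ x)
    inj : ∀ {ℓ ℓ′} → ρ⟨ ℓ ⟩ ≗ ρ⟨ ℓ′ ⟩ → ℓ ≡ ℓ′
    inj = reflection-injective
    hits : ∀ ℓ → ρ⟨ ℓ ⟩ ≗ σ ⊎ ρ⟨ ℓ ⟩ ≗ τ ⊎ ρ⟨ ℓ ⟩ ≗ στ
    hits ℓ = case classify ρ⟨ ℓ ⟩ (reflection-isFAut ℓ) of λ where
      (inj₁ ρℓ≗id) → ⊥-elim (reflection-nontrivial ℓ ρℓ≗id)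
      (inj₂ h)     → h
    via : ∀ {g} → ρ ≗ g → (∃ λ ℓ → ρ⟨ ℓ ⟩ ≗ g) → ∃ λ ℓ → ρ ≗ ρ⟨ ℓ ⟩
    via ρ≗g (ℓ , ρℓ≗g) = ℓ , λ x → trans (ρ≗g x) (sym (ρℓ≗g x))

  -- the reflections of P are automorphisms, hence reflections of Q; s and t of P lie on the lines they fix
  module _ (EA : IsElementaryAbelian E) (P : BiquadraticBasis E) where
    private
      module P = Reflections 2≉0 P
      module P′ = BiquadraticBasis P

    squares-on-reflected-lines : ∀ ℓ₁ ℓ₂ → P.ρ⟨ ⟨t⟩ ⟩ ≗ ρ⟨ ℓ₁ ⟩ → P.ρ⟨ ⟨s⟩ ⟩ ≗ ρ⟨ ℓ₂ ⟩ →
                                 ℓ₁ ≢ ℓ₂ × SquaresOnLines P′.a P′.b ℓ₁ ℓ₂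
    squares-on-reflected-lines ℓ₁ ℓ₂ ρₜ≗ρℓ₁ ρₛ≗ρℓ₂ =
      ℓ₁≢ℓ₂ ,
      eigenvector-square-class {ℓ₁} {ℓ₂} {P′.t} {P′.b} (transfer ρₜ≗ρℓ₁ (P.reflection-fixes ⟨t⟩))
                                                        (transfer ρₛ≗ρℓ₂ (P.reflection-negates {⟨s⟩} {⟨t⟩} λ ())) P′.t²≈b ,
      eigenvector-square-class {ℓ₂} {ℓ₁} {P′.s} {P′.a} (transfer ρₛ≗ρℓ₂ (P.reflection-fixes ⟨s⟩))
                                                        (transfer ρₜ≗ρℓ₁ (P.reflection-negates {⟨t⟩} {⟨s⟩} λ ())) P′.s²≈a
      where
      transfer : ∀ {ρ σ : Carrier → Carrier} {x y} → ρ ≗ σ → ρ x ≈ y → σ x ≈ y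
      transfer {x = x} ρ≗σ ρx≈y = trans (sym (ρ≗σ x)) ρx≈y
      ℓ₁≢ℓ₂ : ℓ₁ ≢ ℓ₂
      ℓ₁≢ℓ₂ ℓ₁≡ℓ₂ = case P.reflection-injective {⟨t⟩} {⟨s⟩}
        (λ x → trans (ρₜ≗ρℓ₁ x) (trans (reflexive (≡.cong (λ ℓ → ρ⟨ ℓ ⟩ x) ℓ₁≡ℓ₂)) (sym (ρₛ≗ρℓ₂ x)))) of λ ()

    reflection-of : ∀ ℓ → ∃ λ ℓ′ → P.ρ⟨ ℓ ⟩ ≗ ρ⟨ ℓ′ ⟩
    reflection-of ℓ = case automorphism-classification EA (P.reflection-isFAut ℓ) of λ where
      (inj₁ ρ≗id) → ⊥-elim (P.reflection-nontrivial ℓ ρ≗id)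
      (inj₂ r)    → r

    basis-squares-on-lines : ∃₂ λ ℓ₁ ℓ₂ → ℓ₁ ≢ ℓ₂ × SquaresOnLines P′.a P′.b ℓ₁ ℓ₂
    basis-squares-on-lines = case reflection-of ⟨t⟩ of λ where
      (ℓ₁ , ρₜ≗ρℓ₁) → case reflection-of ⟨s⟩ of λ where
        (ℓ₂ , ρₛ≗ρℓ₂) → ℓ₁ , ℓ₂ , squares-on-reflected-lines ℓ₁ ℓ₂ ρₜ≗ρℓ₁ ρₛ≗ρℓ₂

module Isomorphisms {f ℓ f₁ ℓ₁ f₂ ℓ₂} {F : Field f ℓ} {E₁ : Extension F f₁ ℓ₁} {E₂ : Extension F f₂ ℓ₂} where
  private
    module L₁ = Field (Extension.L E₁)
    module L₂ = Field (Extension.L E₂)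

  Inverses : FHom E₁ E₂ → FHom E₂ E₁ → Set (f₁ ⊔ ℓ₁ ⊔ f₂ ⊔ ℓ₂)
  Inverses φ ψ = (∀ x → FHom.to ψ (FHom.to φ x) L₁.≈ x) × (∀ y → FHom.to φ (FHom.to ψ y) L₂.≈ y)

  FIsomorphic⇒inverses : FIsomorphic E₁ E₂ → Σ (FHom E₁ E₂) λ φ → Σ (FHom E₂ E₁) λ ψ → Inverses φ ψ
  FIsomorphic⇒inverses (φ , ψ , φ-cong , φ-+ , φ-* , φ-1 , φ-ι , ψ-cong , ψφ , φψ) = φᴴ , ψᴴ , ψφ , φψ
    where
    φᴴ : FHom E₁ E₂
    φᴴ = record { to = φ ; cong = φ-cong ; +-homo = φ-+ ; *-homo = φ-* ; 1#-homo = φ-1 ; ι-homo = φ-ι }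

    ψᴴ : FHom E₂ E₁
    ψᴴ = record
      { to      = ψ
      ; cong    = ψ-cong
      ; +-homo  = λ x y → L₁.trans (ψ-cong (L₂.trans (L₂.+-cong (L₂.sym (φψ x)) (L₂.sym (φψ y))) (L₂.sym (φ-+ _ _)))) (ψφ _)
      ; *-homo  = λ x y → L₁.trans (ψ-cong (L₂.trans (L₂.*-cong (L₂.sym (φψ x)) (L₂.sym (φψ y))) (L₂.sym (φ-* _ _)))) (ψφ _)
      ; 1#-homo = L₁.trans (ψ-cong (L₂.sym φ-1)) (ψφ _)
      ; ι-homo  = λ p → L₁.trans (ψ-cong (L₂.sym (φ-ι p))) (ψφ _)
      }

  inverses⇒FIsomorphic : (φ : FHom E₁ E₂) (ψ : FHom E₂ E₁) → Inverses φ ψ → FIsomorphic E₁ E₂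
  inverses⇒FIsomorphic φ ψ (ψφ , φψ) =
    φ.to , ψ.to , φ.cong , φ.+-homo , φ.*-homo , φ.1#-homo , φ.ι-homo , ψ.cong , ψφ , φψ
    where
    module φ = FHom φ
    module ψ = FHom ψ

  pullback : (φ : FHom E₁ E₂) (ψ : FHom E₂ E₁) → Inverses φ ψ → BiquadraticBasis E₂ → BiquadraticBasis E₁
  pullback φ ψ (ψφ , φψ) Q = record
    { s = ψ.to s ; t = ψ.to t ; a = a ; b = b
    ; s²≈a = L₁.trans (L₁.sym (ψ.*-homo s s)) (L₁.trans (ψ.cong s²≈a) (ψ.ι-homo a))
    ; t²≈b = L₁.trans (L₁.sym (ψ.*-homo t t)) (L₁.trans (ψ.cong t²≈b) (ψ.ι-homo b))
    ; spans = λ x → coords (φ.to x) , L₁.trans (L₁.sym (ψφ x))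
        (L₁.trans (ψ.cong (coords-sound (φ.to x))) (combo-homo ψ s t (coords (φ.to x))))
    ; independent = λ c c≈0 → independent c (L₂.trans (L₂.sym (C₂.combo-congˢᵗ c (φψ s) (φψ t)))
        (L₂.trans (L₂.sym (combo-homo φ (ψ.to s) (ψ.to t) c)) (L₂.trans (φ.cong c≈0) (FHomProperties.0#-homo φ))))
    }
    where
    open BasisProperties Q
    open FHomProperties using (combo-homo)
    module C₂ = Combinations E₂
    module φ = FHom φ
    module ψ = FHom ψ

module Rebasing {f ℓ f′ ℓ′} {F : Field f ℓ} {E : Extension F f′ ℓ′} (Q : BiquadraticBasis E) where
  open BasisProperties Q
  private
    module F = Field F
  open Field (Extension.L E)
  open ExtensionProperties E
  open Combinations E
  open ℤ-RingSolver cring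
  open import Relation.Binary.Reasoning.Setoid setoid

  rebase : ∀ {s′ t′ a′ b′} → s′ * s′ ≈ ι a′ → t′ * t′ ≈ ι b′ →
           (into : (Fin 4 → F.Carrier) → Fin 4 → F.Carrier) → (∀ c → combo s t c ≈ combo s′ t′ (into c)) →
           (back : (Fin 4 → F.Carrier) → Fin 4 → F.Carrier) → (∀ d → combo s′ t′ d ≈ combo s t (back d)) →
           (∀ d → (∀ i → back d i F.≈ F.0#) → ∀ i → d i F.≈ F.0#) → BiquadraticBasis E
  rebase {s′} {t′} {a′} {b′} s′²≈a′ t′²≈b′ into into-sound back back-sound back-faithful = record
    { s = s′ ; t = t′ ; a = a′ ; b = b′ ; s²≈a = s′²≈a′ ; t²≈b = t′²≈b′
    ; spans       = λ x → into (coords x) , trans (coords-sound x) (into-sound (coords x))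
    ; independent = λ d d≈0 → back-faithful d (independent (back d) (trans (sym (back-sound d)) d≈0))
    }

  swapped : BiquadraticBasis E
  swapped = rebase t²≈b s²≈a swap (swap-sound s t) swap (swap-sound t s)
    λ d swap≈0 → λ { 0F → swap≈0 0F ; 1F → swap≈0 2F ; 2F → swap≈0 1F ; 3F → swap≈0 3F }
    where
    swap : (Fin 4 → F.Carrier) → Fin 4 → F.Carrier
    swap c = ⟨ c 0F , c 2F , c 1F , c 3F ⟩
    swap-sound : ∀ s t c → combo s t c ≈ combo t s (swap c)
    swap-sound s t c = solve 6 (λ c₀ c₁ c₂ c₃ s t →
        c₀ :* con (1 , 0) :+ (c₁ :* s :+ (c₂ :* t :+ c₃ :* (s :* t)))
     := c₀ :* con (1 , 0) :+ (c₂ :* t :+ (c₁ :* s :+ c₃ :* (t :* s))))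
      refl (ι (c 0F)) (ι (c 1F)) (ι (c 2F)) (ι (c 3F)) s t

  -- the basis 1, s, st, s·st = a t
  multiplied : BiquadraticBasis E
  multiplied = rebase s²≈a (gen² ⟨st⟩) into into-sound back back-sound back-faithful
    where
    open FieldProperties F using (_⁻¹⟨_⟩; ⁻¹-inverseˡ; x*y≈0⇒y≈0)
    a≉0 = square≉0 ⟨s⟩
    a⁻¹ = a ⁻¹⟨ a≉0 ⟩

    into back : (Fin 4 → F.Carrier) → Fin 4 → F.Carrier
    into c = ⟨ c 0F , c 1F , c 3F , c 2F F.* a⁻¹ ⟩
    back d = ⟨ d 0F , d 1F , d 3F F.* a , d 2F ⟩

    into-sound : ∀ c → combo s t c ≈ combo s (s * t) (into c)
    into-sound c = sym (begin
      combo s (s * t) (into c)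
        ≈⟨ +-congˡ (+-congˡ (+-congˡ (*-congʳ (ι-* _ a⁻¹)))) ⟩
      c₀ * 1# + (c₁ * s + (c₃ * (s * t) + c₂ * A * (s * (s * t))))
        ≈⟨ solve 7 (λ c₀ c₁ c₂ c₃ A s t →
              c₀ :* con (1 , 0) :+ (c₁ :* s :+ (c₃ :* (s :* t) :+ c₂ :* A :* (s :* (s :* t))))
           := c₀ :* con (1 , 0) :+ (c₁ :* s :+ (c₂ :* (A :* (s :* s)) :* t :+ c₃ :* (s :* t))))
            refl c₀ c₁ c₂ c₃ A s t ⟩
      c₀ * 1# + (c₁ * s + (c₂ * (A * (s * s)) * t + c₃ * (s * t)))
        ≈⟨ +-congˡ (+-congˡ (+-congʳ (*-congʳ (*-congˡ (trans (*-congˡ s²≈a) (ι-inverse (⁻¹-inverseˡ a a≉0))))))) ⟩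
      c₀ * 1# + (c₁ * s + (c₂ * 1# * t + c₃ * (s * t)))
        ≈⟨ +-congˡ (+-congˡ (+-congʳ (*-congʳ (*-identityʳ c₂)))) ⟩
      combo s t c ∎)
      where
      c₀ = ι (c 0F) ; c₁ = ι (c 1F) ; c₂ = ι (c 2F) ; c₃ = ι (c 3F) ; A = ι a⁻¹

    back-sound : ∀ d → combo s (s * t) d ≈ combo s t (back d)
    back-sound d = sym (begin
      combo s t (back d)
        ≈⟨ +-congˡ (+-congˡ (+-congʳ (*-congʳ (trans (ι-* _ a) (*-congˡ (sym s²≈a)))))) ⟩
      d₀ * 1# + (d₁ * s + (d₃ * (s * s) * t + d₂ * (s * t)))
        ≈⟨ solve 6 (λ d₀ d₁ d₂ d₃ s t →
              d₀ :* con (1 , 0) :+ (d₁ :* s :+ (d₃ :* (s :* s) :* t :+ d₂ :* (s :* t)))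
           := d₀ :* con (1 , 0) :+ (d₁ :* s :+ (d₂ :* (s :* t) :+ d₃ :* (s :* (s :* t)))))
            refl d₀ d₁ d₂ d₃ s t ⟩
      combo s (s * t) d ∎)
      where
      d₀ = ι (d 0F) ; d₁ = ι (d 1F) ; d₂ = ι (d 2F) ; d₃ = ι (d 3F)

    back-faithful : ∀ d → (∀ i → back d i F.≈ F.0#) → ∀ i → d i F.≈ F.0#
    back-faithful d back≈0 0F = back≈0 0F
    back-faithful d back≈0 1F = back≈0 1F
    back-faithful d back≈0 2F = back≈0 3F
    back-faithful d back≈0 3F = x*y≈0⇒y≈0 a≉0 (F.trans (F.*-comm a _) (back≈0 2F))

module _ {f ℓ f′ ℓ′} {F : Field f ℓ} {E : Extension F f′ ℓ′} where
  private
    module F = Field F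
  open BiquadraticBasis using (a; b)
  open Rebasing using (swapped; multiplied)

  basis-on-lines : (Q : BiquadraticBasis E) → ∀ {ℓ₁ ℓ₂} → ℓ₁ ≢ ℓ₂ → let open BasisProperties Q in
                   Σ (BiquadraticBasis E) λ Q₀ → a Q₀ F.≈ square ℓ₁ × b Q₀ F.≈ square ℓ₂
  basis-on-lines Q {⟨s⟩}  {⟨t⟩}  _ = Q , F.refl , F.refl
  basis-on-lines Q {⟨t⟩}  {⟨s⟩}  _ = swapped Q , F.refl , F.refl
  basis-on-lines Q {⟨s⟩}  {⟨st⟩} _ = multiplied Q , F.refl , F.refl
  basis-on-lines Q {⟨st⟩} {⟨s⟩}  _ = swapped (multiplied Q) , F.refl , F.refl
  basis-on-lines Q {⟨t⟩}  {⟨st⟩} _ = multiplied (swapped Q) , F.refl , F.*-comm (b Q) (a Q)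
  basis-on-lines Q {⟨st⟩} {⟨t⟩}  _ = swapped (multiplied (swapped Q)) , F.*-comm (b Q) (a Q) , F.refl
  basis-on-lines Q {⟨s⟩}  {⟨s⟩}  ℓ₁≢ℓ₂ = ⊥-elim (ℓ₁≢ℓ₂ ≡.refl)
  basis-on-lines Q {⟨t⟩}  {⟨t⟩}  ℓ₁≢ℓ₂ = ⊥-elim (ℓ₁≢ℓ₂ ≡.refl)
  basis-on-lines Q {⟨st⟩} {⟨st⟩} ℓ₁≢ℓ₂ = ⊥-elim (ℓ₁≢ℓ₂ ≡.refl)

SquareQuot-congʳ : ∀ {c ℓ} (F : Field c ℓ) {n d d′} → Field._≈_ F d d′ → SquareQuot F n d′ → SquareQuot F n d
SquareQuot-congʳ F d≈d′ (d′≉0 , α , n≈α²d′) = d′≉0 ∘ trans (sym d≈d′) , α , trans n≈α²d′ (*-congˡ (sym d≈d′))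
  where open Field F

module _ {f ℓ f₁ ℓ₁ f₂ ℓ₂} {F : Field f ℓ} {E₁ : Extension F f₁ ℓ₁} {E₂ : Extension F f₂ ℓ₂} where
  private
    module F = Field F
    module L₁ = Field (Extension.L E₁)
    module L₂ = Field (Extension.L E₂)
    module X₁ = ExtensionProperties E₁
    module X₂ = ExtensionProperties E₂

  scaled-round-trip : (φ : FHom E₁ E₂) (ψ : FHom E₂ E₁) {g₁ : L₁.Carrier} {g₂ : L₂.Carrier} {γ δ : F.Carrier} →
                      FHom.to φ g₁ L₂.≈ X₂.ι γ L₂.* g₂ → FHom.to ψ g₂ L₁.≈ X₁.ι δ L₁.* g₁ → γ F.* δ F.≈ F.1# →
                      FHom.to ψ (FHom.to φ g₁) L₁.≈ g₁
  scaled-round-trip φ ψ {g₁} {g₂} {γ} φg₁≈γg₂ ψg₂≈δg₁ γδ≈1 = L₁.trans (FHom.cong ψ φg₁≈γg₂)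
    (L₁.trans (FHomProperties.scalar-homo ψ γ g₂) (L₁.trans (L₁.*-congˡ ψg₂≈δg₁) (X₁.ι-cancel g₁ γδ≈1)))

module _ {f ℓ f₁ ℓ₁ f₂ ℓ₂} {F : Field f ℓ} {E₁ : Extension F f₁ ℓ₁} {E₂ : Extension F f₂ ℓ₂} where
  private
    module F = Field F
    module L₁ = Field (Extension.L E₁)
    module L₂ = Field (Extension.L E₂)
    module X₁ = ExtensionProperties E₁
    module X₂ = ExtensionProperties E₂
  open FieldProperties F using (_⁻¹⟨_⟩; ⁻¹-inverseˡ; ⁻¹-inverseʳ; x*y≈1⇒y²x²z≈z; x≈y²z⇒y≉0)
  open Isomorphisms using (inverses⇒FIsomorphic)
  open BiquadraticBasis using (a; b)

  -- s ↦ α⁻¹ s′, t ↦ β⁻¹ t′ and its inverse s′ ↦ α s, t′ ↦ β t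
  isomorphic-if-square-classes-match : (Q₁ : BiquadraticBasis E₁) (Q₂ : BiquadraticBasis E₂) →
    SquareQuot F (a Q₂) (a Q₁) → SquareQuot F (b Q₂) (b Q₁) → FIsomorphic E₁ E₂
  isomorphic-if-square-classes-match Q₁ Q₂ (_ , α , a₂≈α²a₁) (_ , β , b₂≈β²b₁) =
    inverses⇒FIsomorphic φ ψ (ψφ , φψ)
    where
    module Q₁ = BasisProperties Q₁
    module Q₂ = BasisProperties Q₂
    α≉0 = x≈y²z⇒y≉0 (Q₂.square≉0 ⟨s⟩) a₂≈α²a₁
    β≉0 = x≈y²z⇒y≉0 (Q₂.square≉0 ⟨t⟩) b₂≈β²b₁
    α⁻¹ = α ⁻¹⟨ α≉0 ⟩
    β⁻¹ = β ⁻¹⟨ β≉0 ⟩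

    φ-s² = L₂.trans (X₂.ι-scaled-square α⁻¹ Q₂.s²≈a)
             (X₂.ι-cong (F.trans (F.*-congˡ a₂≈α²a₁) (x*y≈1⇒y²x²z≈z Q₁.a (⁻¹-inverseʳ α α≉0))))
    φ-t² = L₂.trans (X₂.ι-scaled-square β⁻¹ Q₂.t²≈b)
             (X₂.ι-cong (F.trans (F.*-congˡ b₂≈β²b₁) (x*y≈1⇒y²x²z≈z Q₁.b (⁻¹-inverseʳ β β≉0))))
    ψ-s² = L₁.trans (X₁.ι-scaled-square α Q₁.s²≈a) (X₁.ι-cong (F.sym a₂≈α²a₁))
    ψ-t² = L₁.trans (X₁.ι-scaled-square β Q₁.t²≈b) (X₁.ι-cong (F.sym b₂≈β²b₁))

    φ : FHom E₁ E₂
    φ = Q₁.lift {E′ = E₂} φ-s² φ-t²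

    ψ : FHom E₂ E₁
    ψ = Q₂.lift {E′ = E₁} ψ-s² ψ-t²

    ψφ : ∀ x → FHom.to ψ (FHom.to φ x) L₁.≈ x
    ψφ = Q₁.FHom-ext (ψ ∘ᴴ φ) idᴴ
      (scaled-round-trip φ ψ (Q₁.lift-gen {E′ = E₂} φ-s² φ-t² ⟨s⟩) (Q₂.lift-gen {E′ = E₁} ψ-s² ψ-t² ⟨s⟩) (⁻¹-inverseˡ α α≉0))
      (scaled-round-trip φ ψ (Q₁.lift-gen {E′ = E₂} φ-s² φ-t² ⟨t⟩) (Q₂.lift-gen {E′ = E₁} ψ-s² ψ-t² ⟨t⟩) (⁻¹-inverseˡ β β≉0))

    φψ : ∀ y → FHom.to φ (FHom.to ψ y) L₂.≈ y
    φψ = Q₂.FHom-ext (φ ∘ᴴ ψ) idᴴ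
      (scaled-round-trip ψ φ (Q₂.lift-gen {E′ = E₁} ψ-s² ψ-t² ⟨s⟩) (Q₁.lift-gen {E′ = E₂} φ-s² φ-t² ⟨s⟩) (⁻¹-inverseʳ α α≉0))
      (scaled-round-trip ψ φ (Q₂.lift-gen {E′ = E₁} ψ-s² ψ-t² ⟨t⟩) (Q₁.lift-gen {E′ = E₂} φ-s² φ-t² ⟨t⟩) (⁻¹-inverseʳ β β≉0))


module LineCriterion {f ℓ f₁ ℓ₁ f₂ ℓ₂} {F : Field f ℓ} (2≉0 : CharNot2 F)
                     {E₁ : Extension F f₁ ℓ₁} {E₂ : Extension F f₂ ℓ₂}
                     (Q₁ : BiquadraticBasis E₁) (Q₂ : BiquadraticBasis E₂) where
  open BasisProperties Q₁ using (SquaresOnLines)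
  open BiquadraticBasis Q₂ using () renaming (a to a₂; b to b₂)
  open Isomorphisms using (FIsomorphic⇒inverses; pullback)
  open Automorphisms 2≉0 Q₁ using (basis-squares-on-lines)

  isomorphic⇒squares-on-lines : IsElementaryAbelian E₁ → FIsomorphic E₁ E₂ →
                                ∃₂ λ ℓ₁ ℓ₂ → ℓ₁ ≢ ℓ₂ × SquaresOnLines a₂ b₂ ℓ₁ ℓ₂
  isomorphic⇒squares-on-lines EA iso = case FIsomorphic⇒inverses iso of λ where
    (φ , ψ , inverses) → basis-squares-on-lines EA (pullback φ ψ inverses Q₂)

  squares-on-lines⇒isomorphic : ∀ {ℓ₁ ℓ₂} → ℓ₁ ≢ ℓ₂ → SquaresOnLines a₂ b₂ ℓ₁ ℓ₂ → FIsomorphic E₁ E₂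
  squares-on-lines⇒isomorphic ℓ₁≢ℓ₂ (b₂∈ℓ₁ , a₂∈ℓ₂) = case basis-on-lines Q₁ (ℓ₁≢ℓ₂ ∘ ≡.sym) of λ where
    (Q₀ , a₀≈ , b₀≈) → isomorphic-if-square-classes-match Q₀ Q₂
                         (SquareQuot-congʳ F a₀≈ a₂∈ℓ₂) (SquareQuot-congʳ F b₀≈ b₂∈ℓ₁)

module GeneratorBasis {f ℓ f′ ℓ′} {F : Field f ℓ} (2≉0 : CharNot2 F) {E : Extension F f′ ℓ′}
                      {y : Field.Carrier (Extension.L E)} {u w : Field.Carrier F}
                      (generator : BiquadGen E y u (Field._*_ F w w)) where
  private
    module F = Field F
  open Field (Extension.L E)
  open ExtensionProperties E
  open Combinations E
  open FieldProperties F using (_⁻¹⟨_⟩; ⁻¹-inverseˡ; ⁻¹-inverseʳ; x*y≈0⇒y≈0; x+x≈0⇒x≈0; x+y≈0∧y≈0⇒x≈0; x+y≈0∧x-y≈0⇒x≈0∧y≈0)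
  open FieldProperties (Extension.L E) using (*-nonzero) renaming (x*y≈0⇒y≈0 to x*y≈0⇒y≈0ᴸ)
  open ℤ-RingSolver cring
  open import Relation.Binary.Reasoning.Setoid setoid
  open import Data.Vec.Relation.Binary.Pointwise.Inductive using (_∷_; [])
  open import Data.Vec.Base using (_∷_; [])

  private
    spans-powers = proj₁ generator
    minimal = proj₁ (proj₂ generator)
    independent-powers = proj₂ (proj₂ generator)

  U W : Carrier
  U = ι u
  W = ι w

  linᵖ : (Fin 4 → Carrier) → Carrier
  linᵖ x = x 0F * 1# + (x 1F * y + (x 2F * (y * y) + x 3F * (y * y * y)))

  powers-ι : ∀ {c x} → (∀ i → ι (c i) ≈ x i) → lin4 E c (powers E y) ≈ linᵖ x
  powers-ι c≈x = +-cong (*-congʳ (c≈x 0F))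
    (+-cong (*-congʳ (c≈x 1F)) (+-cong (*-congʳ (c≈x 2F)) (*-congʳ (c≈x 3F))))

  y⁴+Uy²≈-W² : y * y * y * y + U * (y * y) ≈ - (W * W)
  y⁴+Uy²≈-W² = begin
    y * y * y * y + U * (y * y)                     ≈⟨ solve 2 (λ X Y → X := X :+ Y :- Y) refl _ (ι (w F.* w)) ⟩
    y * y * y * y + U * (y * y) + ι (w F.* w) - ι (w F.* w)  ≈⟨ +-congʳ minimal ⟩
    0# - ι (w F.* w)                               ≈⟨ +-identityˡ _ ⟩
    - ι (w F.* w)                                  ≈⟨ -‿cong (ι-* w w) ⟩
    - (W * W)                                      ∎

  y²≉0 : ¬ y * y ≈ 0#
  y²≉0 = *-nonzero y≉0 y≉0
    where
    y≉0 : ¬ y ≈ 0#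
    y≉0 y≈0 = F.1≉0 (independent-powers ⟨ F.0# , F.1# , F.0# , F.0# ⟩ (begin
      lin4 E ⟨ F.0# , F.1# , F.0# , F.0# ⟩ (powers E y)   ≈⟨ powers-ι {c = ⟨ F.0# , F.1# , F.0# , F.0# ⟩} {x = ⟨ 0# , 1# , 0# , 0# ⟩} (λ { 0F → ι-0# ; 1F → ι-1 ; 2F → ι-0# ; 3F → ι-0# }) ⟩
      linᵖ ⟨ 0# , 1# , 0# , 0# ⟩                          ≈⟨ solve 1 (λ y → con (0 , 0) :* con (1 , 0) :+ (con (1 , 0) :* y :+ (con (0 , 0) :* (y :* y) :+ con (0 , 0) :* (y :* y :* y))) := y) refl y ⟩
      y                                                    ≈⟨ y≈0 ⟩
      0#                                                   ∎) 1F)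

  -- w = 0 would make y² + u vanish, against the minimality of X⁴ + uX² + w²
  w≉0 : ¬ w F.≈ F.0#
  w≉0 w≈0 = F.1≉0 (independent-powers ⟨ u , F.0# , F.1# , F.0# ⟩ (begin
    lin4 E ⟨ u , F.0# , F.1# , F.0# ⟩ (powers E y)   ≈⟨ powers-ι {c = ⟨ u , F.0# , F.1# , F.0# ⟩} {x = ⟨ U , 0# , 1# , 0# ⟩} (λ { 0F → refl ; 1F → ι-0# ; 2F → ι-1 ; 3F → ι-0# }) ⟩
    linᵖ ⟨ U , 0# , 1# , 0# ⟩                        ≈⟨ solve 2 (λ U y → U :* con (1 , 0) :+ (con (0 , 0) :* y :+ (con (1 , 0) :* (y :* y) :+ con (0 , 0) :* (y :* y :* y))) := y :* y :+ U) refl U y ⟩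
    y * y + U                                        ≈⟨ x*y≈0⇒y≈0ᴸ y²≉0 y²[y²+U]≈0 ⟩
    0#                                               ∎) 2F)
    where
    y²[y²+U]≈0 : y * y * (y * y + U) ≈ 0#
    y²[y²+U]≈0 = begin
      y * y * (y * y + U)              ≈⟨ solve 2 (λ y U → y :* y :* (y :* y :+ U) := y :* y :* y :* y :+ U :* (y :* y)) refl y U ⟩
      y * y * y * y + U * (y * y)      ≈⟨ y⁴+Uy²≈-W² ⟩
      - (W * W)                        ≈⟨ -‿cong (*-cong (trans (ι-cong w≈0) ι-0#) (trans (ι-cong w≈0) ι-0#)) ⟩
      - (0# * 0#)                      ≈⟨ solve 0 (:- (con (0 , 0) :* con (0 , 0)) := con (0 , 0)) refl ⟩
      0#                               ∎

  w⁻¹ : F.Carrier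
  w⁻¹ = w ⁻¹⟨ w≉0 ⟩

  W⁻¹ : Carrier
  W⁻¹ = ι w⁻¹

  -- k = w / y, so that y k = w and y ± k are square roots of -u ± 2w
  k : Carrier
  k = - (W⁻¹ * (y * y * y + U * y))

  yk≈W : y * k ≈ W
  yk≈W = begin
    y * k                                   ≈⟨ solve 3 (λ y V U → y :* :- (V :* (y :* y :* y :+ U :* y)) := :- V :* (y :* y :* y :* y :+ U :* (y :* y))) refl y W⁻¹ U ⟩
    - W⁻¹ * (y * y * y * y + U * (y * y))   ≈⟨ *-congˡ y⁴+Uy²≈-W² ⟩
    - W⁻¹ * - (W * W)                       ≈⟨ solve 2 (λ V W → :- V :* :- (W :* W) := V :* W :* W) refl W⁻¹ W ⟩
    W⁻¹ * W * W                             ≈⟨ *-congʳ (ι-inverse (⁻¹-inverseˡ w w≉0)) ⟩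
    1# * W                                  ≈⟨ *-identityˡ W ⟩
    W                                       ∎

  k²≈-[y²+U] : k * k ≈ - (y * y + U)
  k²≈-[y²+U] = begin
    k * k                                                 ≈⟨ solve 3 (λ y V U → :- (V :* (y :* y :* y :+ U :* y)) :* :- (V :* (y :* y :* y :+ U :* y)) := V :* V :* ((y :* y :* y :* y :+ U :* (y :* y)) :* (y :* y :+ U))) refl y W⁻¹ U ⟩
    W⁻¹ * W⁻¹ * ((y * y * y * y + U * (y * y)) * (y * y + U))  ≈⟨ *-congˡ (*-congʳ y⁴+Uy²≈-W²) ⟩
    W⁻¹ * W⁻¹ * (- (W * W) * (y * y + U))                 ≈⟨ solve 4 (λ V W y U → V :* V :* (:- (W :* W) :* (y :* y :+ U)) := :- ((V :* W) :* (V :* W) :* (y :* y :+ U))) refl W⁻¹ W y U ⟩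
    - ((W⁻¹ * W) * (W⁻¹ * W) * (y * y + U))               ≈⟨ -‿cong (*-congʳ (*-cong W⁻¹W≈1 W⁻¹W≈1)) ⟩
    - (1# * 1# * (y * y + U))                             ≈⟨ -‿cong (solve 2 (λ y U → con (1 , 0) :* con (1 , 0) :* (y :* y :+ U) := y :* y :+ U) refl y U) ⟩
    - (y * y + U)                                         ∎
    where W⁻¹W≈1 = ι-inverse (⁻¹-inverseˡ w w≉0)

  s t : Carrier
  s = y + k
  t = y - k

  a b : F.Carrier
  a = F.- u F.+ (F.1# F.+ F.1#) F.* w
  b = F.- u F.- (F.1# F.+ F.1#) F.* w

  ι-2 : ι (F.1# F.+ F.1#) ≈ 1# + 1#
  ι-2 = trans (ι-+ F.1# F.1#) (+-cong ι-1 ι-1)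

  s²≈a : s * s ≈ ι a
  s²≈a = begin
    s * s                                    ≈⟨ solve 2 (λ y k → (y :+ k) :* (y :+ k) := y :* y :+ (con (1 , 0) :+ con (1 , 0)) :* (y :* k) :+ k :* k) refl y k ⟩
    y * y + (1# + 1#) * (y * k) + k * k      ≈⟨ +-cong (+-congˡ (*-congˡ yk≈W)) k²≈-[y²+U] ⟩
    y * y + (1# + 1#) * W - (y * y + U)      ≈⟨ solve 3 (λ y W U → y :* y :+ (con (1 , 0) :+ con (1 , 0)) :* W :- (y :* y :+ U) := :- U :+ (con (1 , 0) :+ con (1 , 0)) :* W) refl y W U ⟩
    - U + (1# + 1#) * W                      ≈⟨ trans (ι-+ _ _) (+-cong (ι-‿ u) (trans (ι-* _ w) (*-congʳ ι-2))) ⟨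
    ι a                                      ∎


  t²≈b : t * t ≈ ι b
  t²≈b = begin
    t * t                                    ≈⟨ solve 2 (λ y k → (y :- k) :* (y :- k) := y :* y :- (con (1 , 0) :+ con (1 , 0)) :* (y :* k) :+ k :* k) refl y k ⟩
    y * y - (1# + 1#) * (y * k) + k * k      ≈⟨ +-cong (+-congˡ (-‿cong (*-congˡ yk≈W))) k²≈-[y²+U] ⟩
    y * y - (1# + 1#) * W - (y * y + U)      ≈⟨ solve 3 (λ y W U → y :* y :- (con (1 , 0) :+ con (1 , 0)) :* W :- (y :* y :+ U) := :- U :- (con (1 , 0) :+ con (1 , 0)) :* W) refl y W U ⟩
    - U - (1# + 1#) * W                      ≈⟨ trans (ι-sub _ _) (+-cong (ι-‿ u) (-‿cong (trans (ι-* _ w) (*-congʳ ι-2)))) ⟨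
    ι b                                      ∎

  st≈2y²+U : s * t ≈ (1# + 1#) * (y * y) + U
  st≈2y²+U = begin
    s * t                    ≈⟨ solve 2 (λ y k → (y :+ k) :* (y :- k) := y :* y :- k :* k) refl y k ⟩
    y * y - k * k            ≈⟨ +-congˡ (-‿cong k²≈-[y²+U]) ⟩
    y * y - - (y * y + U)    ≈⟨ solve 2 (λ y U → y :* y :- :- (y :* y :+ U) := (con (1 , 0) :+ con (1 , 0)) :* (y :* y) :+ U) refl y U ⟩
    (1# + 1#) * (y * y) + U  ∎

  2⁻¹ : F.Carrier
  2⁻¹ = (F.1# F.+ F.1#) ⁻¹⟨ 2≉0 ⟩

  H : Carrier
  H = ι 2⁻¹

  halve : ∀ {X Z} → X ≈ (1# + 1#) * Z → H * X ≈ Z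
  halve {X} {Z} X≈2Z = begin
    H * X                          ≈⟨ *-congˡ X≈2Z ⟩
    H * ((1# + 1#) * Z)            ≈⟨ *-congˡ (*-congʳ ι-2) ⟨
    H * (ι (F.1# F.+ F.1#) * Z)    ≈⟨ ι-cancel Z (⁻¹-inverseˡ _ 2≉0) ⟩
    Z                              ∎

  y≈½[s+t] : y ≈ H * (s + t)
  y≈½[s+t] = sym (halve (solve 2 (λ y k → (y :+ k) :+ (y :- k) := (con (1 , 0) :+ con (1 , 0)) :* y) refl y k))

  k≈½[s-t] : k ≈ H * (s - t)
  k≈½[s-t] = sym (halve (solve 2 (λ y k → (y :+ k) :- (y :- k) := (con (1 , 0) :+ con (1 , 0)) :* k) refl y k))

  y²≈½[st-U] : y * y ≈ H * (s * t - U)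
  y²≈½[st-U] = sym (halve (trans (+-congʳ st≈2y²+U)
    (solve 2 (λ y U → (con (1 , 0) :+ con (1 , 0)) :* (y :* y) :+ U :- U := (con (1 , 0) :+ con (1 , 0)) :* (y :* y)) refl y U)))

  y³≈-Wk-Uy : y * y * y ≈ - (W * k) - U * y
  y³≈-Wk-Uy = begin
    y * y * y                                   ≈⟨ solve 2 (λ y U → y :* y :* y := :- (:- (con (1 , 0) :* (y :* y :* y :+ U :* y))) :- U :* y) refl y U ⟩
    - (- (1# * (y * y * y + U * y))) - U * y    ≈⟨ +-congʳ (-‿cong (-‿cong (*-congʳ (ι-inverse (⁻¹-inverseʳ w w≉0))))) ⟨
    - (- (W * W⁻¹ * (y * y * y + U * y))) - U * y
      ≈⟨ solve 4 (λ W V y U → :- (:- (W :* V :* (y :* y :* y :+ U :* y))) :- U :* y := :- (W :* :- (V :* (y :* y :* y :+ U :* y))) :- U :* y) refl W W⁻¹ y U ⟩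
    - (W * k) - U * y                           ∎

  -- the coordinates of c₀ + c₁ y + c₂ y² + c₃ y³ with respect to 1, s, t, st; variables 4–6 are u, w and 1/2
  spansExpr : Fin 4 → Expr F.Carrier 7
  spansExpr = ⟨ c₀ ⊕ ⊝ (c₂ ⊗ u′ ⊗ h) , (c₁ ⊕ ⊝ (c₃ ⊗ (w′ ⊕ u′))) ⊗ h , (c₁ ⊕ c₃ ⊗ (w′ ⊕ ⊝ u′)) ⊗ h , c₂ ⊗ h ⟩
    where
    c₀ c₁ c₂ c₃ u′ w′ h : Expr F.Carrier 7
    c₀ = Ι 0F ; c₁ = Ι 1F ; c₂ = Ι 2F ; c₃ = Ι 3F ; u′ = Ι 4F ; w′ = Ι 5F ; h = Ι 6F

  from-powers : (Fin 4 → F.Carrier) → Fin 4 → F.Carrier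
  from-powers c i = EvalF.⟦ spansExpr i ⟧ (c 0F ∷ c 1F ∷ c 2F ∷ c 3F ∷ u ∷ w ∷ 2⁻¹ ∷ [])

  spans : Spans4 E (basis s t)
  spans x = from-powers c , (begin
    x                                                    ≈⟨ proj₂ (spans-powers x) ⟩
    linᵖ (ι ∘ c)                                         ≈⟨ +-congˡ (+-cong (*-congˡ y≈½[s+t]) (+-cong (*-congˡ y²≈½[st-U]) (*-congˡ y³≈))) ⟩
    C₀ * 1# + (C₁ * (H * (s + t)) + (C₂ * (H * (s * t - U)) + C₃ * (- (W * (H * (s - t))) - U * (H * (s + t)))))
      ≈⟨ solve 9 (λ C₀ C₁ C₂ C₃ U W H s t →
           C₀ :* con (1 , 0) :+ (C₁ :* (H :* (s :+ t)) :+ (C₂ :* (H :* (s :* t :- U)) :+ C₃ :* (:- (W :* (H :* (s :- t))) :- U :* (H :* (s :+ t)))))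
        := (C₀ :- C₂ :* U :* H) :* con (1 , 0) :+ (((C₁ :- C₃ :* (W :+ U)) :* H) :* s
           :+ (((C₁ :+ C₃ :* (W :- U)) :* H) :* t :+ (C₂ :* H) :* (s :* t))))
         refl C₀ C₁ C₂ C₃ U W H s t ⟩
    lin (λ i → EvalL.⟦ spansExpr i ⟧ (C₀ ∷ C₁ ∷ C₂ ∷ C₃ ∷ U ∷ W ∷ H ∷ [])) s t
      ≈⟨ combo-ι {c = from-powers c} (λ i → ι-eval (spansExpr i) (refl ∷ refl ∷ refl ∷ refl ∷ refl ∷ refl ∷ refl ∷ [])) ⟨
    combo s t (from-powers c)                            ∎)
    where
    c = proj₁ (spans-powers x)
    C₀ = ι (c 0F) ; C₁ = ι (c 1F) ; C₂ = ι (c 2F) ; C₃ = ι (c 3F)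
    y³≈ : y * y * y ≈ - (W * (H * (s - t))) - U * (H * (s + t))
    y³≈ = trans y³≈-Wk-Uy (+-cong (-‿cong (*-congˡ k≈½[s-t])) (-‿cong (*-congˡ y≈½[s+t])))

  -- p + q s + r t + m st rewritten in the powers of y; variables 4 and 5 are u and w⁻¹
  independenceExpr : Fin 4 → Expr F.Carrier 6
  independenceExpr = ⟨ p ⊕ m ⊗ u′ , q ⊕ r ⊕ ⊝ ((q ⊕ ⊝ r) ⊗ v ⊗ u′) , m ⊕ m , ⊝ ((q ⊕ ⊝ r) ⊗ v) ⟩
    where
    p q r m u′ v : Expr F.Carrier 6
    p = Ι 0F ; q = Ι 1F ; r = Ι 2F ; m = Ι 3F ; u′ = Ι 4F ; v = Ι 5F

  to-powers : (Fin 4 → F.Carrier) → Fin 4 → F.Carrier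
  to-powers d i = EvalF.⟦ independenceExpr i ⟧ (d 0F ∷ d 1F ∷ d 2F ∷ d 3F ∷ u ∷ w⁻¹ ∷ [])

  to-powers-sound : ∀ d → lin4 E (to-powers d) (powers E y) ≈ combo s t d
  to-powers-sound d = begin
    lin4 E (to-powers d) (powers E y)
      ≈⟨ powers-ι {c = to-powers d} (λ i → ι-eval (independenceExpr i) (refl ∷ refl ∷ refl ∷ refl ∷ refl ∷ refl ∷ [])) ⟩
    linᵖ (λ i → EvalL.⟦ independenceExpr i ⟧ (P ∷ Q ∷ R ∷ M ∷ U ∷ W⁻¹ ∷ []))
      ≈⟨ solve 7 (λ P Q R M U V y →
           (P :+ M :* U) :* con (1 , 0) :+ ((Q :+ R :- (Q :- R) :* V :* U) :* y
             :+ ((M :+ M) :* (y :* y) :+ (:- ((Q :- R) :* V)) :* (y :* y :* y)))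
        := P :* con (1 , 0) :+ (Q :* (y :+ :- (V :* (y :* y :* y :+ U :* y)))
             :+ (R :* (y :- :- (V :* (y :* y :* y :+ U :* y)))
             :+ M :* ((con (1 , 0) :+ con (1 , 0)) :* (y :* y) :+ U))))
         refl P Q R M U W⁻¹ y ⟩
    P * 1# + (Q * s + (R * t + M * ((1# + 1#) * (y * y) + U)))
      ≈⟨ +-congˡ (+-congˡ (+-congˡ (*-congˡ st≈2y²+U))) ⟨
    combo s t d ∎
    where P = ι (d 0F) ; Q = ι (d 1F) ; R = ι (d 2F) ; M = ι (d 3F)

  independent : Independent4 E (basis s t)
  independent d d≈0 = λ { 0F → p≈0 ; 1F → q≈0 ; 2F → r≈0 ; 3F → m≈0 }
    where
    open import Algebra.Properties.Ring F.ring using (-0#≈0#; -‿involutive)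
    z : ∀ i → to-powers d i F.≈ F.0#
    z = independent-powers (to-powers d) (trans (to-powers-sound d) d≈0)
    w⁻¹≉0 : ¬ w⁻¹ F.≈ F.0#
    w⁻¹≉0 w⁻¹≈0 = F.1≉0 (F.trans (F.sym (⁻¹-inverseʳ w w≉0)) (F.trans (F.*-congˡ w⁻¹≈0) (F.zeroʳ w)))
    -x≈0⇒x≈0 : ∀ {x} → F.- x F.≈ F.0# → x F.≈ F.0#
    -x≈0⇒x≈0 -x≈0 = F.trans (F.sym (-‿involutive _)) (F.trans (F.-‿cong -x≈0) -0#≈0#)
    m≈0 : d 3F F.≈ F.0#
    m≈0 = x+x≈0⇒x≈0 2≉0 (z 2F)
    q-r≈0 : d 1F F.- d 2F F.≈ F.0#
    q-r≈0 = x*y≈0⇒y≈0 w⁻¹≉0 (F.trans (F.*-comm w⁻¹ _) (-x≈0⇒x≈0 (z 3F)))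
    q+r≈0 : d 1F F.+ d 2F F.≈ F.0#
    q+r≈0 = x+y≈0∧y≈0⇒x≈0 (z 1F) (F.trans (F.-‿cong (F.trans (F.*-congʳ (F.*-congʳ q-r≈0)) (F.trans (F.*-congʳ (F.zeroˡ _)) (F.zeroˡ u)))) -0#≈0#)
    q≈0 = proj₁ (x+y≈0∧x-y≈0⇒x≈0∧y≈0 2≉0 q+r≈0 q-r≈0)
    r≈0 = proj₂ (x+y≈0∧x-y≈0⇒x≈0∧y≈0 2≉0 q+r≈0 q-r≈0)
    p≈0 : d 0F F.≈ F.0#
    p≈0 = x+y≈0∧y≈0⇒x≈0 (z 0F) (F.trans (F.*-congʳ m≈0) (F.zeroˡ u))

generator-basis : ∀ {f ℓ f′ ℓ′} {F : Field f ℓ} → CharNot2 F → {E : Extension F f′ ℓ′} {y : Field.Carrier (Extension.L E)}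
                  {u w : Field.Carrier F} → BiquadGen E y u (Field._*_ F w w) → BiquadraticBasis E
generator-basis 2≉0 {E} {y} {u} {w} generator = record
  { s = s ; t = t ; a = a ; b = b ; s²≈a = s²≈a ; t²≈b = t²≈b ; spans = spans ; independent = independent }
  where open GeneratorBasis 2≉0 {E} {y} {u} {w} generator

module _ {p} (P : Line → Line → Set p) where

  AnyDistinctPair : Set p
  AnyDistinctPair = P ⟨s⟩ ⟨t⟩ ⊎ P ⟨s⟩ ⟨st⟩ ⊎ P ⟨t⟩ ⟨s⟩ ⊎ P ⟨t⟩ ⟨st⟩ ⊎ P ⟨st⟩ ⟨t⟩ ⊎ P ⟨st⟩ ⟨s⟩

  any-distinct-pair : ∀ {ℓ₁ ℓ₂} → ℓ₁ ≢ ℓ₂ → P ℓ₁ ℓ₂ → AnyDistinctPair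
  any-distinct-pair {⟨s⟩}  {⟨t⟩}  _ = inj₁
  any-distinct-pair {⟨s⟩}  {⟨st⟩} _ = inj₂ ∘ inj₁
  any-distinct-pair {⟨t⟩}  {⟨s⟩}  _ = inj₂ ∘ inj₂ ∘ inj₁
  any-distinct-pair {⟨t⟩}  {⟨st⟩} _ = inj₂ ∘ inj₂ ∘ inj₂ ∘ inj₁
  any-distinct-pair {⟨st⟩} {⟨t⟩}  _ = inj₂ ∘ inj₂ ∘ inj₂ ∘ inj₂ ∘ inj₁
  any-distinct-pair {⟨st⟩} {⟨s⟩}  _ = inj₂ ∘ inj₂ ∘ inj₂ ∘ inj₂ ∘ inj₂
  any-distinct-pair {⟨s⟩}  {⟨s⟩}  ℓ₁≢ℓ₂ = ⊥-elim (ℓ₁≢ℓ₂ ≡.refl)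
  any-distinct-pair {⟨t⟩}  {⟨t⟩}  ℓ₁≢ℓ₂ = ⊥-elim (ℓ₁≢ℓ₂ ≡.refl)
  any-distinct-pair {⟨st⟩} {⟨st⟩} ℓ₁≢ℓ₂ = ⊥-elim (ℓ₁≢ℓ₂ ≡.refl)

  any-distinct-pair⁻¹ : AnyDistinctPair → ∃₂ λ ℓ₁ ℓ₂ → ℓ₁ ≢ ℓ₂ × P ℓ₁ ℓ₂
  any-distinct-pair⁻¹ (inj₁ p)                                = ⟨s⟩  , ⟨t⟩  , (λ ()) , p
  any-distinct-pair⁻¹ (inj₂ (inj₁ p))                         = ⟨s⟩  , ⟨st⟩ , (λ ()) , p
  any-distinct-pair⁻¹ (inj₂ (inj₂ (inj₁ p)))                  = ⟨t⟩  , ⟨s⟩  , (λ ()) , p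
  any-distinct-pair⁻¹ (inj₂ (inj₂ (inj₂ (inj₁ p))))           = ⟨t⟩  , ⟨st⟩ , (λ ()) , p
  any-distinct-pair⁻¹ (inj₂ (inj₂ (inj₂ (inj₂ (inj₁ p)))))    = ⟨st⟩ , ⟨t⟩  , (λ ()) , p
  any-distinct-pair⁻¹ (inj₂ (inj₂ (inj₂ (inj₂ (inj₂ p)))))    = ⟨st⟩ , ⟨s⟩  , (λ ()) , p

theorem3p8 : ∀ {c ℓ c₁ ℓ₁ c₂ ℓ₂} (F : Field c ℓ) → CharNot2 F → let open Field F in (E : Extension F c₁ ℓ₁) → IsElementaryAbelian E → (y : Field.Carrier (Extension.L E)) → (u w : Carrier) → BiquadGen E y u (w * w) → (E' : Extension F c₂ ℓ₂) → IsBiquadratic E' → (y' : Field.Carrier (Extension.L E')) → (v z : Carrier) → BiquadGen E' y' v (z * z) → FIsomorphic E E' ⇔ ((SquareQuot F (- v - (1# + 1#) * z) (- u + (1# + 1#) * w) × SquareQuot F (- v + (1# + 1#) * z) (- u - (1# + 1#) * w)) ⊎ (SquareQuot F (- v - (1# + 1#) * z) (- u + (1# + 1#) * w) × SquareQuot F (- v + (1# + 1#) * z) (u * u - (1# + 1# + 1# + 1#) * (w * w))) ⊎ (SquareQuot F (- v - (1# + 1#) * z) (- u - (1# + 1#) * w) × SquareQuot F (- v + (1# + 1#) * z) (- u + (1# + 1#) * w)) ⊎ (SquareQuot F (- v - (1# + 1#) * z) (- u - (1# + 1#) * w) × SquareQuot F (- v + (1# + 1#) * z) (u * u - (1# + 1#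 + 1# + 1#) * (w * w))) ⊎ (SquareQuot F (- v - (1# + 1#) * z) (u * u - (1# + 1# + 1# + 1#) * (w * w)) × SquareQuot F (- v + (1# + 1#) * z) (- u - (1# + 1#) * w)) ⊎ (SquareQuot F (- v - (1# + 1#) * z) (u * u - (1# + 1# + 1# + 1#) * (w * w)) × SquareQuot F (- v + (1# + 1#) * z) (- u + (1# + 1#) * w)))
theorem3p8 {c} {ℓ} F 2≉0 E EA y u w generator E′ _ y′ v z generator′ = mk⇔
  (λ iso → case isomorphic⇒squares-on-lines EA iso of λ where
    (ℓ₁ , ℓ₂ , ℓ₁≢ℓ₂ , squares) → any-distinct-pair Conditions ℓ₁≢ℓ₂ (to-conditions {ℓ₁} {ℓ₂} squares))
  (λ conditions → case any-distinct-pair⁻¹ Conditions conditions of λ where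
    (ℓ₁ , ℓ₂ , ℓ₁≢ℓ₂ , cond) → squares-on-lines⇒isomorphic ℓ₁≢ℓ₂ (from-conditions {ℓ₁} {ℓ₂} cond))
  where
  module F = Field F
  Q : BiquadraticBasis E
  Q = generator-basis 2≉0 {E} {y} {u} {w} generator
  Q′ : BiquadraticBasis E′
  Q′ = generator-basis 2≉0 {E′} {y′} {v} {z} generator′
  open LineCriterion 2≉0 Q Q′ using (isomorphic⇒squares-on-lines; squares-on-lines⇒isomorphic)
  open BasisProperties Q using (square; SquaresOnLines)
  open BiquadraticBasis Q′ using () renaming (a to a′; b to b′)

  -- square ⟨st⟩ = (-u + 2w)(-u - 2w), written as in the statement
  squareᴰ : Line → F.Carrier
  squareᴰ ⟨st⟩ = u F.* u F.- (F.1# F.+ F.1# F.+ F.1# F.+ F.1#) F.* (w F.* w)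
  squareᴰ ℓ    = square ℓ

  square≈ : ∀ ℓ → square ℓ F.≈ squareᴰ ℓ
  square≈ ⟨s⟩  = F.refl
  square≈ ⟨t⟩  = F.refl
  square≈ ⟨st⟩ = solve 2 (λ u w → (:- u :+ (con (1 , 0) :+ con (1 , 0)) :* w) :* (:- u :- (con (1 , 0) :+ con (1 , 0)) :* w)
                             := u :* u :- con (4 , 0) :* (w :* w)) F.refl u w
    where open ℤ-RingSolver F.cring

  Conditions : Line → Line → Set (c ⊔ ℓ)
  Conditions ℓ₁ ℓ₂ = SquareQuot F b′ (squareᴰ ℓ₁) × SquareQuot F a′ (squareᴰ ℓ₂)

  to-conditions : ∀ {ℓ₁ ℓ₂} → SquaresOnLines a′ b′ ℓ₁ ℓ₂ → Conditions ℓ₁ ℓ₂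
  to-conditions {ℓ₁} {ℓ₂} (b′∈ℓ₁ , a′∈ℓ₂) =
    SquareQuot-congʳ F (F.sym (square≈ ℓ₁)) b′∈ℓ₁ , SquareQuot-congʳ F (F.sym (square≈ ℓ₂)) a′∈ℓ₂

  from-conditions : ∀ {ℓ₁ ℓ₂} → Conditions ℓ₁ ℓ₂ → SquaresOnLines a′ b′ ℓ₁ ℓ₂
  from-conditions {ℓ₁} {ℓ₂} (b′∈ℓ₁ , a′∈ℓ₂) = SquareQuot-congʳ F (square≈ ℓ₁) b′∈ℓ₁ , SquareQuot-congʳ F (square≈ ℓ₂) a′∈ℓ₂
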